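{- Let $J=(\sqrt{ -3}-1)/2$ and let $\mathbf c=(c_0,c_1,c_2,\dots)$ be the sequence of complex numbers defined by $\prod_{k\ge 0}(1+Jx^{3^k})=\sum_{n\ge 0}c_nx^n$ (equivalently, $c_0=1$ and $c_{3n}=c_n$, $c_{3n+1}=Jc_n$, $c_{3n+2}=0$ for all $n\ge 0$). For $n\ge 1$, $p\ge 0$ let $H_n^p=(c_{p+i+j-2})_{1\le i,j\le n}$ be the $n\times n$ Hankel matrix of $\mathbf c$ starting at index $p$, and let $|H_n^p|$ be its determinant, with the convention $|H_0^p|=1$. Then for all $n\ge 0$: $$|H_0^0|=1,\quad |H_1^0|=1,\quad |H_{3n}^0|=|H_n^0|,\quad |H_{3n+1}^0|=|H_{n+1}^0|,\quad |H_{3n+2}^0|=-J^2|H_{n+1}^0|,$$ and $$|H_0^1|=1,\quad |H_{3n}^1|=|H_n^1|,\quad |H_{3n+1}^1|=J|H_n^1|,\quad |H_{3n+2}^1|=J|H_{n+1}^1|.$$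
   Context: For a sequence $\mathbf u=(u_k)_{k\ge0}$ of complex numbers, the $(p,n)$-order Hankel matrix is $H_n^p(\mathbf u)=(u_{p+i+j-2})_{1\le i,j\le n}$, i.e. the matrix with first row $u_p,u_{p+1},\dots,u_{p+n-1}$ and last row $u_{p+n-1},\dots,u_{p+2n-2}$; its determinant is denoted $|H_n^p(\mathbf u)|$, and by convention $|H_0^p(\mathbf u)|=1$. Note $J$ is a primitive cube root of unity. -}

module Defs where

open import Data.Nat as ℕ using (ℕ; zero; suc)
open import Data.Nat.DivMod using (_/_; _%_)
open import Data.Integer as ℤ using (ℤ)
open import Data.Fin using (Fin; toℕ; punchIn) renaming (zero to fzero; suc to fsuc)

-- Eisenstein integers ℤ[J] ⊂ ℂ, J = (√-3 - 1)/2, J² = -1 - J.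
-- The element ⟨ a , b ⟩ represents a + b·J.  This is a subring of ℂ containing
-- every c_n, so all Hankel determinants live here and equality in ℤ[J]
-- coincides with equality in ℂ.
record 𝔼 : Set where
  constructor ⟨_,_⟩
  field
    re : ℤ
    jm : ℤ

0E 1E J : 𝔼
0E = ⟨ ℤ.0ℤ , ℤ.0ℤ ⟩
1E = ⟨ ℤ.1ℤ , ℤ.0ℤ ⟩
J  = ⟨ ℤ.0ℤ , ℤ.1ℤ ⟩

_+E_ : 𝔼 → 𝔼 → 𝔼
⟨ a , b ⟩ +E ⟨ c , d ⟩ = ⟨ a ℤ.+ c , b ℤ.+ d ⟩

-E_ : 𝔼 → 𝔼
-E ⟨ a , b ⟩ = ⟨ ℤ.- a , ℤ.- b ⟩

-- (a + bJ)(c + dJ) = (ac - bd) + (ad + bc - bd) J   using J² = -1 - J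
_*E_ : 𝔼 → 𝔼 → 𝔼
⟨ a , b ⟩ *E ⟨ c , d ⟩ = ⟨ a ℤ.* c ℤ.- b ℤ.* d , a ℤ.* d ℤ.+ b ℤ.* c ℤ.- b ℤ.* d ⟩

infixl 6 _+E_
infixl 7 _*E_

-- The sequence c: c₀ = 1, c_{3n} = c_n, c_{3n+1} = J c_n, c_{3n+2} = 0.
-- Computed with fuel (fuel n+1 always suffices, since n/3 < n for n > 0).
c-fuel : ℕ → ℕ → 𝔼
c-fuel zero    _ = 1E
c-fuel (suc f) zero = 1E
c-fuel (suc f) (suc m) with (suc m) % 3
... | 0 = c-fuel f (suc m / 3)
... | 1 = J *E c-fuel f (suc m / 3)
... | _ = 0E

c : ℕ → 𝔼
c n = c-fuel (suc n) n

sumFin : (n : ℕ) → (Fin n → 𝔼) → 𝔼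
sumFin zero    f = 0E
sumFin (suc n) f = f fzero +E sumFin n (λ i → f (fsuc i))

sign : ℕ → 𝔼
sign zero    = 1E
sign (suc k) = -E sign k

det : (n : ℕ) → (Fin n → Fin n → 𝔼) → 𝔼
det zero    M = 1E
det (suc n) M =
  sumFin (suc n) (λ j → sign (toℕ j) *E M fzero j *E det n (λ i k → M (fsuc i) (punchIn j k)))

-- Hankel matrix H_n^p(c) = (c_{p+i+j-2})_{1≤i,j≤n}, here 0-indexed: entry (i,j) is c_{p+i+j}.
Hankel : (p n : ℕ) → Fin n → Fin n → 𝔼
Hankel p n i j = c (p ℕ.+ toℕ i ℕ.+ toℕ j)

-- |H_n^p|  (det of the empty matrix is 1, matching |H_0^p| = 1)
hdet : (p n : ℕ) → 𝔼
hdet p n = det n (Hankel p n)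

-- Let P, Q, R and T be the Hankel determinants of the sequences c(m), c(m + 1), c(m) + c(m + 1)
-- and c(m + 1) + c(m + 2).  Because c(3m) = c(m), c(3m + 1) = J c(m) and c(3m + 2) = 0, the Hankel
-- matrix of order 3n + t of each of these sequences, with rows and columns sorted by residue mod 3,
-- is a 3 × 3 block matrix whose blocks are again Hankel matrices of combinations of shifts of c.  A
-- few block row and column operations make it block triangular, with diagonal blocks J^k, (-J²)^k
-- or 1 times Hankel matrices of the four sequences; this gives twelve recurrences expressing P, Q, R
-- and T at 3n + t through their values at n and n + 1.  They preserve R(m) Q(m) = T(m) P(m + 1) =
-- (-1)^m, which therefore holds for all m by strong induction, and under this invariant the
-- recurrences for P = |H⁰| and Q = |H¹| collapse to the stated ones.

module Submission where

open import Defs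
open import Data.Nat using (ℕ; _+_; _*_)
open import Data.Product using (_×_)
open import Relation.Binary.PropositionalEquality using (_≡_)

open import Algebra.Structures using (IsCommutativeRing)
open import Data.Bool.Base using (Bool; true; false; if_then_else_; not; _∧_) renaming (T to True)
open import Data.Bool.Properties using (T-∧; T-not-≡)
open import Data.Fin.Base using (Fin; toℕ; punchIn) renaming (zero to fzero; suc to fsuc)
open import Data.Integer.Base using (+0; 0ℤ; 1ℤ) renaming (_+_ to _+ᶻ_; _*_ to _*ᶻ_; _-_ to _-ᶻ_; -_ to -ᶻ_)
import Data.Integer.Tactic.RingSolver as ℤ-Solver
open import Data.List.Base using (List; []; _∷_; map; replicate; _++_)
open import Data.Maybe.Base using (just; nothing)
open import Data.Nat.Base using (zero; suc; _<_; _≤_; z≤n; s≤s; z<s; s<s; s≤s⁻¹; _≡ᵇ_; _<ᵇ_; _≤ᵇ_)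
open import Data.Nat.DivMod
  using (_%_; _/_; m%n<n; m≡m%n+[m/n]*n; [m+kn]%n≡m%n; m<n⇒m%n≡m; m*n%n≡0; m*n/n≡m; m<n⇒m/n≡0; +-distrib-/; m/n<m)
open import Data.Nat.Induction using (<-rec)
open import Data.Nat.Properties
  using ( _≟_; _<?_; <-cmp; ≡ᵇ⇒≡; ≡⇒≡ᵇ; <ᵇ⇒<; <⇒<ᵇ; ≤ᵇ⇒≤
        ; ≤-refl; ≤-trans; <-trans; <-≤-trans; <⇒≤; <⇒≢; >⇒≢; ≤⇒≯; ≮⇒≥; m≤n⇒m<n∨m≡n; m≤n⇒∃[o]m+o≡n
        ; n<1+n; n≤1+n; m≤m+n; m<m+n; +-comm; +-assoc; +-suc; +-identityʳ; *-comm
        ; +-monoˡ-≤; +-monoʳ-≤; +-monoˡ-<; +-monoʳ-<; *-monoʳ-≤; +-cancelˡ-<; +-cancelʳ-<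
        ; module ≤-Reasoning )
open import Data.Nat.Tactic.RingSolver using () renaming (solve to ℕ-solve; solve-∀ to ℕ-solve-∀)
open import Data.Product using (_,_; ∃-syntax; proj₁; proj₂)
open import Data.Sum.Base using (_⊎_; inj₁; inj₂)
open import Function.Base using (_∘_; id)
open import Function.Bundles using (Equivalence)
open import Level using (0ℓ)
open import Relation.Binary.Definitions using (tri<; tri≈; tri>)
open import Relation.Binary.PropositionalEquality
  using (_≢_; refl; sym; trans; cong; cong₂; subst; isEquivalence; module ≡-Reasoning)
open import Relation.Nullary using (yes; no; contradiction)
open import Tactic.RingSolver using (solve-∀)
open import Tactic.RingSolver.Core.AlmostCommutativeRing using (AlmostCommutativeRing; fromCommutativeRing)

open ≡-Reasoning
module ≤ = ≤-Reasoning

-- Eisenstein integers as a commutative ring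

infixl 6 _⊕_
infixl 7 _⊗_
infix  8 ⊖_

-- Opaque copies of the operations of Defs: unfolding a product of unknowns into integer
-- arithmetic would defeat unification.  Ring identities are proved by the solver inside
-- `opaque unfolding _⊗_` blocks, where constants such as J ⊗ J compute.
opaque
  _⊕_ _⊗_ : 𝔼 → 𝔼 → 𝔼
  _⊕_ = _+E_
  _⊗_ = _*E_

  ⊖_ : 𝔼 → 𝔼
  ⊖_ = -E_

opaque
  unfolding _⊗_

  ⊕≡+E : ∀ x y → x ⊕ y ≡ x +E y
  ⊕≡+E x y = refl

  ⊗≡*E : ∀ x y → x ⊗ y ≡ x *E y
  ⊗≡*E x y = refl

  ⊖≡-E : ∀ x → ⊖ x ≡ -E x
  ⊖≡-E x = refl

  private
    ⟨,⟩-cong : ∀ {a b c d} → a ≡ c → b ≡ d → ⟨ a , b ⟩ ≡ ⟨ c , d ⟩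
    ⟨,⟩-cong refl refl = refl

  ⊕-assoc : ∀ x y z → (x ⊕ y) ⊕ z ≡ x ⊕ (y ⊕ z)
  ⊕-assoc ⟨ a , b ⟩ ⟨ c , d ⟩ ⟨ e , f ⟩ = ⟨,⟩-cong (law a c e) (law b d f)
    where
    law : ∀ a c e → (a +ᶻ c) +ᶻ e ≡ a +ᶻ (c +ᶻ e)
    law = ℤ-Solver.solve-∀

  ⊕-comm : ∀ x y → x ⊕ y ≡ y ⊕ x
  ⊕-comm ⟨ a , b ⟩ ⟨ c , d ⟩ = ⟨,⟩-cong (law a c) (law b d)
    where
    law : ∀ a c → a +ᶻ c ≡ c +ᶻ a
    law = ℤ-Solver.solve-∀

  ⊕-identityˡ : ∀ x → 0E ⊕ x ≡ x
  ⊕-identityˡ ⟨ a , b ⟩ = ⟨,⟩-cong (law a) (law b)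
    where
    law : ∀ a → 0ℤ +ᶻ a ≡ a
    law = ℤ-Solver.solve-∀

  ⊖-inverseˡ : ∀ x → (⊖ x) ⊕ x ≡ 0E
  ⊖-inverseˡ ⟨ a , b ⟩ = ⟨,⟩-cong (law a) (law b)
    where
    law : ∀ a → -ᶻ a +ᶻ a ≡ 0ℤ
    law = ℤ-Solver.solve-∀

  ⊗-assoc : ∀ x y z → (x ⊗ y) ⊗ z ≡ x ⊗ (y ⊗ z)
  ⊗-assoc ⟨ a , b ⟩ ⟨ c , d ⟩ ⟨ e , f ⟩ = ⟨,⟩-cong (law₁ a b c d e f) (law₂ a b c d e f)
    where
    law₁ : ∀ a b c d e f → (a *ᶻ c -ᶻ b *ᶻ d) *ᶻ e -ᶻ (a *ᶻ d +ᶻ b *ᶻ c -ᶻ b *ᶻ d) *ᶻ f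
                         ≡ a *ᶻ (c *ᶻ e -ᶻ d *ᶻ f) -ᶻ b *ᶻ (c *ᶻ f +ᶻ d *ᶻ e -ᶻ d *ᶻ f)
    law₁ = ℤ-Solver.solve-∀
    law₂ : ∀ a b c d e f →
           (a *ᶻ c -ᶻ b *ᶻ d) *ᶻ f +ᶻ (a *ᶻ d +ᶻ b *ᶻ c -ᶻ b *ᶻ d) *ᶻ e -ᶻ (a *ᶻ d +ᶻ b *ᶻ c -ᶻ b *ᶻ d) *ᶻ f
         ≡ a *ᶻ (c *ᶻ f +ᶻ d *ᶻ e -ᶻ d *ᶻ f) +ᶻ b *ᶻ (c *ᶻ e -ᶻ d *ᶻ f) -ᶻ b *ᶻ (c *ᶻ f +ᶻ d *ᶻ e -ᶻ d *ᶻ f)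
    law₂ = ℤ-Solver.solve-∀

  ⊗-comm : ∀ x y → x ⊗ y ≡ y ⊗ x
  ⊗-comm ⟨ a , b ⟩ ⟨ c , d ⟩ = ⟨,⟩-cong (law₁ a b c d) (law₂ a b c d)
    where
    law₁ : ∀ a b c d → a *ᶻ c -ᶻ b *ᶻ d ≡ c *ᶻ a -ᶻ d *ᶻ b
    law₁ = ℤ-Solver.solve-∀
    law₂ : ∀ a b c d → a *ᶻ d +ᶻ b *ᶻ c -ᶻ b *ᶻ d ≡ c *ᶻ b +ᶻ d *ᶻ a -ᶻ d *ᶻ b
    law₂ = ℤ-Solver.solve-∀

  ⊗-identityˡ : ∀ x → 1E ⊗ x ≡ x
  ⊗-identityˡ ⟨ a , b ⟩ = ⟨,⟩-cong (law₁ a b) (law₂ a b)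
    where
    law₁ : ∀ a b → 1ℤ *ᶻ a -ᶻ 0ℤ *ᶻ b ≡ a
    law₁ = ℤ-Solver.solve-∀
    law₂ : ∀ a b → 1ℤ *ᶻ b +ᶻ 0ℤ *ᶻ a -ᶻ 0ℤ *ᶻ b ≡ b
    law₂ = ℤ-Solver.solve-∀

  ⊗-distribˡ-⊕ : ∀ x y z → x ⊗ (y ⊕ z) ≡ (x ⊗ y) ⊕ (x ⊗ z)
  ⊗-distribˡ-⊕ ⟨ a , b ⟩ ⟨ c , d ⟩ ⟨ e , f ⟩ = ⟨,⟩-cong (law₁ a b c d e f) (law₂ a b c d e f)
    where
    law₁ : ∀ a b c d e f → a *ᶻ (c +ᶻ e) -ᶻ b *ᶻ (d +ᶻ f) ≡ (a *ᶻ c -ᶻ b *ᶻ d) +ᶻ (a *ᶻ e -ᶻ b *ᶻ f)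
    law₁ = ℤ-Solver.solve-∀
    law₂ : ∀ a b c d e f → a *ᶻ (d +ᶻ f) +ᶻ b *ᶻ (c +ᶻ e) -ᶻ b *ᶻ (d +ᶻ f)
                         ≡ (a *ᶻ d +ᶻ b *ᶻ c -ᶻ b *ᶻ d) +ᶻ (a *ᶻ f +ᶻ b *ᶻ e -ᶻ b *ᶻ f)
    law₂ = ℤ-Solver.solve-∀

⊕-identityʳ : ∀ x → x ⊕ 0E ≡ x
⊕-identityʳ x = trans (⊕-comm x 0E) (⊕-identityˡ x)

⊖-inverseʳ : ∀ x → x ⊕ (⊖ x) ≡ 0E
⊖-inverseʳ x = trans (⊕-comm x (⊖ x)) (⊖-inverseˡ x)

⊗-identityʳ : ∀ x → x ⊗ 1E ≡ x
⊗-identityʳ x = trans (⊗-comm x 1E) (⊗-identityˡ x)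

⊗-distribʳ-⊕ : ∀ x y z → (y ⊕ z) ⊗ x ≡ (y ⊗ x) ⊕ (z ⊗ x)
⊗-distribʳ-⊕ x y z = begin
  (y ⊕ z) ⊗ x      ≡⟨ ⊗-comm (y ⊕ z) x ⟩
  x ⊗ (y ⊕ z)      ≡⟨ ⊗-distribˡ-⊕ x y z ⟩
  x ⊗ y ⊕ x ⊗ z    ≡⟨ cong₂ _⊕_ (⊗-comm x y) (⊗-comm x z) ⟩
  y ⊗ x ⊕ z ⊗ x    ∎

𝔼-isCommutativeRing : IsCommutativeRing _≡_ _⊕_ _⊗_ ⊖_ 0E 1E
𝔼-isCommutativeRing = record
  { isRing = record
    { +-isAbelianGroup = record
      { isGroup = record
        { isMonoid = record
          { isSemigroup = record
            { isMagma = record { isEquivalence = isEquivalence ; ∙-cong = cong₂ _⊕_ }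
            ; assoc = ⊕-assoc }
          ; identity = ⊕-identityˡ , ⊕-identityʳ }
        ; inverse = ⊖-inverseˡ , ⊖-inverseʳ
        ; ⁻¹-cong = cong ⊖_ }
      ; comm = ⊕-comm }
    ; *-cong = cong₂ _⊗_
    ; *-assoc = ⊗-assoc
    ; *-identity = ⊗-identityˡ , ⊗-identityʳ
    ; distrib = ⊗-distribˡ-⊕ , ⊗-distribʳ-⊕ }
  ; *-comm = ⊗-comm }

𝔼-ring : AlmostCommutativeRing 0ℓ 0ℓ
𝔼-ring = fromCommutativeRing (record { isCommutativeRing = 𝔼-isCommutativeRing })
  λ { ⟨ +0 , +0 ⟩ → just refl ; _ → nothing }

opaque
  unfolding _⊗_

  ⊗-zeroˡ : ∀ x → 0E ⊗ x ≡ 0E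
  ⊗-zeroˡ = solve-∀ 𝔼-ring

  ⊗-zeroʳ : ∀ x → x ⊗ 0E ≡ 0E
  ⊗-zeroʳ = solve-∀ 𝔼-ring

  ⊖-involutive : ∀ x → ⊖ (⊖ x) ≡ x
  ⊖-involutive = solve-∀ 𝔼-ring

  ⊖-0E : ⊖ 0E ≡ 0E
  ⊖-0E = solve-∀ 𝔼-ring

⊕-⊗-zeroʳ : ∀ x a → x ⊕ a ⊗ 0E ≡ x
⊕-⊗-zeroʳ x a = trans (cong (x ⊕_) (⊗-zeroʳ a)) (⊕-identityʳ x)

⊕-⊗-zeroˡ : ∀ x y → x ⊕ 0E ⊗ y ≡ x
⊕-⊗-zeroˡ x y = trans (cong (x ⊕_) (⊗-zeroˡ y)) (⊕-identityʳ x)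

x⊕y≡0⇒y≡⊖x : ∀ x y → x ⊕ y ≡ 0E → y ≡ ⊖ x
x⊕y≡0⇒y≡⊖x x y x+y≡0 = begin
  y                ≡⟨ regroup x y ⟩
  ⊖ x ⊕ (x ⊕ y)    ≡⟨ cong (⊖ x ⊕_) x+y≡0 ⟩
  ⊖ x ⊕ 0E         ≡⟨ ⊕-identityʳ (⊖ x) ⟩
  ⊖ x              ∎
  where
  opaque
    unfolding _⊗_
    regroup : ∀ x y → y ≡ ⊖ x ⊕ (x ⊕ y)
    regroup = solve-∀ 𝔼-ring

private
  3q+r≡r+q*3 : ∀ q r → 3 * q + r ≡ r + q * 3
  3q+r≡r+q*3 q r = trans (+-comm (3 * q) r) (cong (r +_) (*-comm 3 q))

[3q+r]%3≡r : ∀ q {r} → r < 3 → (3 * q + r) % 3 ≡ r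
[3q+r]%3≡r q {r} r<3 = begin
  (3 * q + r) % 3  ≡⟨ cong (_% 3) (3q+r≡r+q*3 q r) ⟩
  (r + q * 3) % 3  ≡⟨ [m+kn]%n≡m%n r q 3 ⟩
  r % 3            ≡⟨ m<n⇒m%n≡m r<3 ⟩
  r                ∎

[3q+r]/3≡q : ∀ q {r} → r < 3 → (3 * q + r) / 3 ≡ q
[3q+r]/3≡q q {r} r<3 = begin
  (3 * q + r) / 3    ≡⟨ cong (_/ 3) (3q+r≡r+q*3 q r) ⟩
  (r + q * 3) / 3    ≡⟨ +-distrib-/ r (q * 3) remainders<3 ⟩
  r / 3 + q * 3 / 3  ≡⟨ cong₂ _+_ (m<n⇒m/n≡0 r<3) (m*n/n≡m q 3) ⟩
  q                  ∎
  where
  remainders<3 : r % 3 + q * 3 % 3 < 3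
  remainders<3 = subst (_< 3) (sym (trans (cong₂ _+_ (m<n⇒m%n≡m r<3) (m*n%n≡0 q 3)) (+-identityʳ r))) r<3

m≡3[m/3]+m%3 : ∀ m → m ≡ 3 * (m / 3) + m % 3
m≡3[m/3]+m%3 m = trans (m≡m%n+[m/n]*n m 3) (trans (+-comm (m % 3) _) (cong (_+ m % 3) (*-comm (m / 3) 3)))

digitFactor : ℕ → 𝔼
digitFactor 0 = 1E
digitFactor 1 = J
digitFactor _ = 0E

c-fuel-suc : ∀ f k → c-fuel (suc f) (suc k) ≡ digitFactor (suc k % 3) ⊗ c-fuel f (suc k / 3)
c-fuel-suc f k with suc k % 3
... | 0           = sym (⊗-identityˡ _)
... | 1           = sym (⊗≡*E J _)
... | suc (suc _) = sym (⊗-zeroˡ (c-fuel f (suc k / 3)))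

c-fuel-stable : ∀ {f g} n → n < f → n < g → c-fuel f n ≡ c-fuel g n
c-fuel-stable {suc f} {suc g} zero    _         _         = refl
c-fuel-stable {suc f} {suc g} (suc k) (s<s k<f) (s<s k<g) = begin
  c-fuel (suc f) (suc k)                          ≡⟨ c-fuel-suc f k ⟩
  digitFactor (suc k % 3) ⊗ c-fuel f (suc k / 3)  ≡⟨ cong (digitFactor (suc k % 3) ⊗_) same-below ⟩
  digitFactor (suc k % 3) ⊗ c-fuel g (suc k / 3)  ≡⟨ c-fuel-suc g k ⟨
  c-fuel (suc g) (suc k)                          ∎
  where
  k/3<k : suc k / 3 < suc k
  k/3<k = m/n<m (suc k) 3 (s≤s (s≤s z≤n))
  same-below : c-fuel f (suc k / 3) ≡ c-fuel g (suc k / 3)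
  same-below = c-fuel-stable _ (<-≤-trans k/3<k k<f) (<-≤-trans k/3<k k<g)

c-suc : ∀ k → c (suc k) ≡ digitFactor (suc k % 3) ⊗ c (suc k / 3)
c-suc k = trans (c-fuel-suc (suc k) k)
  (cong (digitFactor (suc k % 3) ⊗_) (c-fuel-stable _ (m/n<m (suc k) 3 (s≤s (s≤s z≤n))) ≤-refl))

private
  c-digit-suc : ∀ q r {k} → suc k ≡ 3 * q + r → r < 3 → c (suc k) ≡ digitFactor r ⊗ c q
  c-digit-suc q r {k} k+1≡3q+r r<3 = trans (c-suc k)
    (cong₂ (λ d m → digitFactor d ⊗ c m) (trans (cong (_% 3) k+1≡3q+r) ([3q+r]%3≡r q r<3))
                                          (trans (cong (_/ 3) k+1≡3q+r) ([3q+r]/3≡q q r<3)))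

c-digit : ∀ q r → r < 3 → c (3 * q + r) ≡ digitFactor r ⊗ c q
c-digit zero    zero    _   = sym (⊗-identityˡ 1E)
c-digit zero    (suc r) r<3 = c-digit-suc zero (suc r) refl r<3
c-digit (suc q) r       r<3 = c-digit-suc (suc q) r refl r<3

-- Determinants of ℕ-indexed matrices

-- det′ n M reads only the leading n × n block of M; indexing by ℕ makes every reindexing ℕ → ℕ a
-- matrix operation.
Matrix : Set
Matrix = ℕ → ℕ → 𝔼

-- Opaque, so that ∑ (suc n) f does not unfold and unification can recover f.
opaque
  ∑ : ℕ → (ℕ → 𝔼) → 𝔼
  ∑ zero    f = 0E
  ∑ (suc n) f = f 0 ⊕ ∑ n (λ j → f (suc j))

  ∑-empty : ∀ (f : ℕ → 𝔼) → ∑ 0 f ≡ 0E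
  ∑-empty f = refl

  ∑-suc : ∀ n (f : ℕ → 𝔼) → ∑ (suc n) f ≡ f 0 ⊕ ∑ n (λ j → f (suc j))
  ∑-suc n f = refl

  ∑-one : ∀ (f : ℕ → 𝔼) → ∑ 1 f ≡ f 0 ⊕ 0E
  ∑-one f = refl

  ∑-cong : ∀ n {f g : ℕ → 𝔼} → (∀ j → j < n → f j ≡ g j) → ∑ n f ≡ ∑ n g
  ∑-cong zero    f≡g = refl
  ∑-cong (suc n) f≡g = cong₂ _⊕_ (f≡g 0 z<s) (∑-cong n (λ j j<n → f≡g (suc j) (s<s j<n)))

  ∑-distrib-⊕ : ∀ n (f g : ℕ → 𝔼) → ∑ n (λ j → f j ⊕ g j) ≡ ∑ n f ⊕ ∑ n g
  ∑-distrib-⊕ zero    f g = sym (⊕-identityˡ 0E)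
  ∑-distrib-⊕ (suc n) f g = trans (cong (f 0 ⊕ g 0 ⊕_) (∑-distrib-⊕ n _ _)) (interchange (f 0) (g 0) _ _)
    where
    opaque
      unfolding _⊗_
      interchange : ∀ a b x y → a ⊕ b ⊕ (x ⊕ y) ≡ a ⊕ x ⊕ (b ⊕ y)
      interchange = solve-∀ 𝔼-ring

  ∑-factorˡ : ∀ n a (f : ℕ → 𝔼) → ∑ n (λ j → a ⊗ f j) ≡ a ⊗ ∑ n f
  ∑-factorˡ zero    a f = sym (⊗-zeroʳ a)
  ∑-factorˡ (suc n) a f = trans (cong (a ⊗ f 0 ⊕_) (∑-factorˡ n a _)) (sym (⊗-distribˡ-⊕ a (f 0) _))

  ∑-0E : ∀ n {f : ℕ → 𝔼} → (∀ j → j < n → f j ≡ 0E) → ∑ n f ≡ 0E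
  ∑-0E n f≡0 = trans (∑-cong n f≡0) (∑-const-0E n)
    where
    ∑-const-0E : ∀ n → ∑ n (λ _ → 0E) ≡ 0E
    ∑-const-0E zero    = refl
    ∑-const-0E (suc n) = trans (cong (0E ⊕_) (∑-const-0E n)) (⊕-identityˡ 0E)

  ∑-swap : ∀ n m (f : ℕ → ℕ → 𝔼) → ∑ n (λ i → ∑ m (f i)) ≡ ∑ m (λ j → ∑ n (λ i → f i j))
  ∑-swap zero    m f = sym (∑-0E m (λ _ _ → refl))
  ∑-swap (suc n) m f = trans (cong (∑ m (f 0) ⊕_) (∑-swap n m (λ i → f (suc i))))
                             (sym (∑-distrib-⊕ m (f 0) (λ j → ∑ n (λ i → f (suc i) j))))

  ∑-linear : ∀ n (f g : ℕ → 𝔼) a → ∑ n (λ j → f j ⊕ a ⊗ g j) ≡ ∑ n f ⊕ a ⊗ ∑ n g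
  ∑-linear n f g a = trans (∑-distrib-⊕ n f (λ j → a ⊗ g j)) (cong (∑ n f ⊕_) (∑-factorˡ n a g))

  ∑-split : ∀ a b (f : ℕ → 𝔼) → ∑ (a + b) f ≡ ∑ a f ⊕ ∑ b (λ j → f (a + j))
  ∑-split zero    b f = sym (⊕-identityˡ _)
  ∑-split (suc a) b f = trans (cong (f 0 ⊕_) (∑-split a b _)) (sym (⊕-assoc (f 0) _ _))

punchInℕ : ℕ → ℕ → ℕ
punchInℕ zero    k       = suc k
punchInℕ (suc j) zero    = zero
punchInℕ (suc j) (suc k) = suc (punchInℕ j k)

minor : ℕ → ℕ → Matrix → Matrix
minor i j M k l = M (punchInℕ i k) (punchInℕ j l)

sgn : ℕ → 𝔼
sgn zero    = 1E
sgn (suc k) = ⊖ sgn k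

det′ : ℕ → Matrix → 𝔼
det′ zero    M = 1E
det′ (suc n) M = ∑ (suc n) (λ j → sgn j ⊗ M 0 j ⊗ det′ n (minor 0 j M))

punchInℕ-< : ∀ j {k n} → k < n → punchInℕ j k < suc n
punchInℕ-< zero    k<n       = s<s k<n
punchInℕ-< (suc j) {zero} _  = z<s
punchInℕ-< (suc j) {suc k} (s<s k<n) = s<s (punchInℕ-< j k<n)

det′-cong : ∀ n {M N : Matrix} → (∀ i j → i < n → j < n → M i j ≡ N i j) → det′ n M ≡ det′ n N
det′-cong zero    M≡N = refl
det′-cong (suc n) M≡N = ∑-cong (suc n) λ j j<n →
  cong₂ _⊗_ (cong (sgn j ⊗_) (M≡N 0 j z<s j<n))
             (det′-cong n (λ i k i<n k<n → M≡N (suc i) (punchInℕ j k) (s<s i<n) (punchInℕ-< j k<n)))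

sign≡sgn : ∀ k → sign k ≡ sgn k
sign≡sgn zero    = refl
sign≡sgn (suc k) = trans (cong -E_ (sign≡sgn k)) (sym (⊖≡-E (sgn k)))

toℕ-punchIn : ∀ {n} (j : Fin (suc n)) (k : Fin n) → toℕ (punchIn j k) ≡ punchInℕ (toℕ j) (toℕ k)
toℕ-punchIn fzero    k        = refl
toℕ-punchIn (fsuc j) fzero    = refl
toℕ-punchIn (fsuc j) (fsuc k) = cong suc (toℕ-punchIn j k)

sumFin≡∑ : ∀ n {f : Fin n → 𝔼} {g : ℕ → 𝔼} → (∀ j → f j ≡ g (toℕ j)) → sumFin n f ≡ ∑ n g
sumFin≡∑ zero    f≡g = sym (∑-empty _)
sumFin≡∑ (suc n) f≡g = trans (cong₂ _+E_ (f≡g fzero) (sumFin≡∑ n (λ j → f≡g (fsuc j))))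
                              (trans (sym (⊕≡+E _ _)) (sym (∑-suc n _)))

det≡det′ : ∀ n (A : Fin n → Fin n → 𝔼) (M : Matrix) → (∀ i j → A i j ≡ M (toℕ i) (toℕ j)) → det n A ≡ det′ n M
det≡det′ zero    A M A≡M = refl
det≡det′ (suc n) A M A≡M = sumFin≡∑ (suc n) λ j → begin
  sign (toℕ j) *E A fzero j *E det n (A′ j)
    ≡⟨ cong₂ (λ s a → s *E a *E det n (A′ j)) (sign≡sgn (toℕ j)) (A≡M fzero j) ⟩
  sgn (toℕ j) *E M 0 (toℕ j) *E det n (A′ j)
    ≡⟨ cong (sgn (toℕ j) *E M 0 (toℕ j) *E_) (det≡det′ n (A′ j) (minor 0 (toℕ j) M) (minor-entries j)) ⟩
  sgn (toℕ j) *E M 0 (toℕ j) *E det′ n (minor 0 (toℕ j) M)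
    ≡⟨ as-⊗ (sgn (toℕ j)) (M 0 (toℕ j)) (det′ n (minor 0 (toℕ j) M)) ⟩
  sgn (toℕ j) ⊗ M 0 (toℕ j) ⊗ det′ n (minor 0 (toℕ j) M) ∎
  where
  A′ : Fin (suc n) → Fin n → Fin n → 𝔼
  A′ j i k = A (fsuc i) (punchIn j k)
  minor-entries : ∀ j i k → A′ j i k ≡ minor 0 (toℕ j) M (toℕ i) (toℕ k)
  minor-entries j i k = trans (A≡M (fsuc i) (punchIn j k)) (cong (M (suc (toℕ i))) (toℕ-punchIn j k))
  opaque
    unfolding _⊗_
    as-⊗ : ∀ s a d → s *E a *E d ≡ s ⊗ a ⊗ d
    as-⊗ s a d = refl

det′-expand-col₀ : ∀ n M → det′ (suc n) M ≡ ∑ (suc n) (λ i → sgn i ⊗ M i 0 ⊗ det′ n (minor i 0 M))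
det′-expand-col₀ zero    M = trans (∑-one _) (sym (∑-one _))
det′-expand-col₀ (suc m) M = begin
  det′ (suc (suc m)) M
    ≡⟨ ∑-suc (suc m) _ ⟩
  sgn 0 ⊗ M 0 0 ⊗ det′ (suc m) (minor 0 0 M) ⊕ ∑ (suc m) (λ j → a j ⊗ det′ (suc m) (minor 0 (suc j) M))
    ≡⟨ cong (sgn 0 ⊗ M 0 0 ⊗ det′ (suc m) (minor 0 0 M) ⊕_) tails ⟩
  sgn 0 ⊗ M 0 0 ⊗ det′ (suc m) (minor 0 0 M) ⊕ ∑ (suc m) (λ i → b i ⊗ det′ (suc m) (minor (suc i) 0 M))
    ≡⟨ ∑-suc (suc m) _ ⟨
  ∑ (suc (suc m)) (λ i → sgn i ⊗ M i 0 ⊗ det′ (suc m) (minor i 0 M))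
    ∎
  where
  a b : ℕ → 𝔼
  a j = sgn (suc j) ⊗ M 0 (suc j)
  b i = sgn (suc i) ⊗ M (suc i) 0
  N : ℕ → ℕ → Matrix
  N i j = minor i j (minor 0 0 M)
  opaque
    unfolding _⊗_
    regroup : ∀ sj si x y d → ⊖ sj ⊗ x ⊗ (si ⊗ y ⊗ d) ≡ ⊖ si ⊗ y ⊗ (sj ⊗ x ⊗ d)
    regroup = solve-∀ 𝔼-ring
  tails : ∑ (suc m) (λ j → a j ⊗ det′ (suc m) (minor 0 (suc j) M))
        ≡ ∑ (suc m) (λ i → b i ⊗ det′ (suc m) (minor (suc i) 0 M))
  tails = begin
    ∑ (suc m) (λ j → a j ⊗ det′ (suc m) (minor 0 (suc j) M))
      ≡⟨ ∑-cong (suc m) (λ j _ → cong (a j ⊗_) (det′-expand-col₀ m (minor 0 (suc j) M))) ⟩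
    ∑ (suc m) (λ j → a j ⊗ ∑ (suc m) (λ i → sgn i ⊗ M (suc i) 0 ⊗ det′ m (N i j)))
      ≡⟨ ∑-cong (suc m) (λ j _ → sym (∑-factorˡ (suc m) (a j) _)) ⟩
    ∑ (suc m) (λ j → ∑ (suc m) (λ i → a j ⊗ (sgn i ⊗ M (suc i) 0 ⊗ det′ m (N i j))))
      ≡⟨ ∑-swap (suc m) (suc m) _ ⟩
    ∑ (suc m) (λ i → ∑ (suc m) (λ j → a j ⊗ (sgn i ⊗ M (suc i) 0 ⊗ det′ m (N i j))))
      ≡⟨ ∑-cong (suc m) (λ i _ → ∑-cong (suc m) (λ j _ →
           regroup (sgn j) (sgn i) (M 0 (suc j)) (M (suc i) 0) (det′ m (N i j)))) ⟩
    ∑ (suc m) (λ i → ∑ (suc m) (λ j → b i ⊗ (sgn j ⊗ M 0 (suc j) ⊗ det′ m (N i j))))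
      ≡⟨ ∑-cong (suc m) (λ i _ → ∑-factorˡ (suc m) (b i) _) ⟩
    ∑ (suc m) (λ i → b i ⊗ det′ (suc m) (minor (suc i) 0 M))
      ∎

det′-transpose : ∀ n M → det′ n (λ i j → M j i) ≡ det′ n M
det′-transpose zero    M = refl
det′-transpose (suc n) M = trans
  (∑-cong (suc n) (λ j _ → cong (sgn j ⊗ M j 0 ⊗_) (det′-transpose n (minor j 0 M))))
  (sym (det′-expand-col₀ n M))

-- Row operations

-- Tested with _≡ᵇ_, which reduces suc i ≡ᵇ suc p to i ≡ᵇ p: the minors of setRow (suc p) v M along
-- row 0 are then definitionally row updates of the minors of M.
setRow : ℕ → (ℕ → 𝔼) → Matrix → Matrix
setRow p v M i j = if i ≡ᵇ p then v j else M i j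

setRow-hit : ∀ p v M j → setRow p v M p j ≡ v j
setRow-hit p v M j with p ≡ᵇ p | ≡⇒≡ᵇ p p refl
... | true | _ = refl

setRow-miss : ∀ {p} v M {i} j → i ≢ p → setRow p v M i j ≡ M i j
setRow-miss {p} v M {i} j i≢p with i ≡ᵇ p | ≡ᵇ⇒≡ i p
... | true  | i≡p = contradiction (i≡p _) i≢p
... | false | _   = refl

setRow-id : ∀ {p v} M → (∀ j → v j ≡ M p j) → ∀ i j → setRow p v M i j ≡ M i j
setRow-id {p} M v≡Mp i j with i ≡ᵇ p | ≡ᵇ⇒≡ i p
... | true  | i≡p = trans (v≡Mp j) (cong (λ k → M k j) (sym (i≡p _)))
... | false | _   = refl

setRow-comm : ∀ {p q} → p ≢ q → ∀ x y M i j → setRow p x (setRow q y M) i j ≡ setRow q y (setRow p x M) i j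
setRow-comm {p} {q} p≢q x y M i j with i ≡ᵇ p | ≡ᵇ⇒≡ i p | i ≡ᵇ q | ≡ᵇ⇒≡ i q
... | true  | i≡p | true  | i≡q = contradiction (trans (sym (i≡p _)) (i≡q _)) p≢q
... | true  | _   | false | _   = refl
... | false | _   | true  | _   = refl
... | false | _   | false | _   = refl

det′-linear-row : ∀ n p → p < n → ∀ M u w a →
  det′ n (setRow p (λ j → u j ⊕ a ⊗ w j) M) ≡ det′ n (setRow p u M) ⊕ a ⊗ det′ n (setRow p w M)
det′-linear-row (suc n) zero _ M u w a =
  trans (∑-cong (suc n) λ j _ → distrib (sgn j) (u j) (w j) a (det′ n (minor 0 j M))) (∑-linear (suc n) _ _ a)
  where
  opaque
    unfolding _⊗_
    distrib : ∀ s x y a d → s ⊗ (x ⊕ a ⊗ y) ⊗ d ≡ s ⊗ x ⊗ d ⊕ a ⊗ (s ⊗ y ⊗ d)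
    distrib = solve-∀ 𝔼-ring
det′-linear-row (suc n) (suc p) (s<s p<n) M u w a =
  trans (∑-cong (suc n) λ j _ →
           trans (cong (sgn j ⊗ M 0 j ⊗_)
                       (det′-linear-row n p p<n (minor 0 j M) (λ k → u (punchInℕ j k)) (λ k → w (punchInℕ j k)) a))
                 (distrib (sgn j ⊗ M 0 j) _ _ a))
        (∑-linear (suc n) _ _ a)
  where
  opaque
    unfolding _⊗_
    distrib : ∀ s x y a → s ⊗ (x ⊕ a ⊗ y) ≡ s ⊗ x ⊕ a ⊗ (s ⊗ y)
    distrib = solve-∀ 𝔼-ring

-- For p = 0 expand along column 0: the terms of rows 0 and 1 cancel, and every other minor again has
-- two equal adjacent rows.
det′-adjacent-equal-rows : ∀ n p → suc p < n → ∀ M → (∀ j → M p j ≡ M (suc p) j) → det′ n M ≡ 0E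
det′-adjacent-equal-rows (suc n) (suc p) (s<s p<n) M h = ∑-0E (suc n) λ j _ →
  trans (cong (sgn j ⊗ M 0 j ⊗_) (det′-adjacent-equal-rows n p p<n (minor 0 j M) (λ k → h (punchInℕ j k))))
        (⊗-zeroʳ _)
det′-adjacent-equal-rows (suc zero) zero (s<s ()) M h
det′-adjacent-equal-rows (suc (suc m)) zero _ M h = begin
  det′ (suc (suc m)) M
    ≡⟨ det′-expand-col₀ (suc m) M ⟩
  ∑ (suc (suc m)) term
    ≡⟨ trans (∑-suc (suc m) term) (cong (term 0 ⊕_) (∑-suc m _)) ⟩
  term 0 ⊕ (term 1 ⊕ ∑ m (λ i → term (suc (suc i))))
    ≡⟨ cong₂ (λ x y → term 0 ⊕ (x ⊕ y)) term₁≡-term₀ (∑-0E m λ i i<m →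
         trans (cong (_ ⊗_) (det′-adjacent-equal-rows (suc m) 0 (s<s (≤-trans (s≤s z≤n) i<m))
                                                      (minor (suc (suc i)) 0 M) (λ l → h (suc l))))
               (⊗-zeroʳ _)) ⟩
  term 0 ⊕ (⊖ term 0 ⊕ 0E)
    ≡⟨ cancel (term 0) ⟩
  0E ∎
  where
  term : ℕ → 𝔼
  term i = sgn i ⊗ M i 0 ⊗ det′ (suc m) (minor i 0 M)
  term₁≡-term₀ : term 1 ≡ ⊖ term 0
  term₁≡-term₀ = trans (cong₂ (λ x d → ⊖ 1E ⊗ x ⊗ d) (sym (h 0)) same-minor) (negate (M 0 0) _)
    where
    same-minor : det′ (suc m) (minor 1 0 M) ≡ det′ (suc m) (minor 0 0 M)
    same-minor = det′-cong (suc m) {minor 1 0 M} {minor 0 0 M} λ { zero l _ _ → h (suc l) ; (suc k) l _ _ → refl }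
    opaque
      unfolding _⊗_
      negate : ∀ x d → ⊖ 1E ⊗ x ⊗ d ≡ ⊖ (1E ⊗ x ⊗ d)
      negate = solve-∀ 𝔼-ring
  opaque
    unfolding _⊗_
    cancel : ∀ x → x ⊕ (⊖ x ⊕ 0E) ≡ 0E
    cancel = solve-∀ 𝔼-ring

swapℕ : ℕ → ℕ → ℕ
swapℕ zero    zero          = 1
swapℕ zero    (suc zero)    = 0
swapℕ zero    (suc (suc i)) = suc (suc i)
swapℕ (suc p) zero          = zero
swapℕ (suc p) (suc i)       = suc (swapℕ p i)

swapℕ-hit : ∀ p → swapℕ p p ≡ suc p
swapℕ-hit zero    = refl
swapℕ-hit (suc p) = cong suc (swapℕ-hit p)

swapℕ-hit′ : ∀ p → swapℕ p (suc p) ≡ p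
swapℕ-hit′ zero    = refl
swapℕ-hit′ (suc p) = cong suc (swapℕ-hit′ p)

swapℕ-miss : ∀ p {i} → i ≢ p → i ≢ suc p → swapℕ p i ≡ i
swapℕ-miss zero    {zero}        i≢0 _   = contradiction refl i≢0
swapℕ-miss zero    {suc zero}    _   i≢1 = contradiction refl i≢1
swapℕ-miss zero    {suc (suc i)} _   _   = refl
swapℕ-miss (suc p) {zero}        _   _   = refl
swapℕ-miss (suc p) {suc i}       i≢p i≢p+1 = cong suc (swapℕ-miss p (i≢p ∘ cong suc) (i≢p+1 ∘ cong suc))

swapRows : ℕ → Matrix → Matrix
swapRows p M i j = M (swapℕ p i) j

setRow-swap : ∀ p M i j → setRow p (M (suc p)) (setRow (suc p) (M p) M) i j ≡ swapRows p M i j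
setRow-swap p M i j with i ≟ p | i ≟ suc p
... | yes refl | _        = trans (setRow-hit i (M (suc i)) M′ j) (cong (λ k → M k j) (sym (swapℕ-hit i)))
  where M′ = setRow (suc i) (M i) M
... | no i≢p   | yes refl = trans (setRow-miss (M i) (setRow i (M p) M) j i≢p)
                                  (trans (setRow-hit i (M p) M j) (cong (λ k → M k j) (sym (swapℕ-hit′ p))))
... | no i≢p   | no i≢p+1 = trans (setRow-miss (M (suc p)) (setRow (suc p) (M p) M) j i≢p)
                                  (trans (setRow-miss (M p) M j i≢p+1) (cong (λ k → M k j) (sym (swapℕ-miss p i≢p i≢p+1))))

-- With Z x y the determinant with rows p and p + 1 replaced by x and y, expand Z (a + b) (a + b) = 0
-- in both rows: Z a a = Z b b = 0, so Z a b + Z b a = 0.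
det′-swapRows : ∀ n p → suc p < n → ∀ M → det′ n (swapRows p M) ≡ ⊖ det′ n M
det′-swapRows n p p+1<n M = x⊕y≡0⇒y≡⊖x (det′ n M) (det′ n (swapRows p M)) (begin
  det′ n M ⊕ det′ n (swapRows p M)
    ≡⟨ cong₂ _⊕_ (sym Z-a-b) (sym Z-b-a) ⟩
  Z a b ⊕ Z b a
    ≡⟨ simplify (Z a b) (Z b a) ⟨
  (0E ⊕ 1E ⊗ Z a b) ⊕ 1E ⊗ (Z b a ⊕ 1E ⊗ 0E)
    ≡⟨ cong₂ (λ u v → (u ⊕ 1E ⊗ Z a b) ⊕ 1E ⊗ (Z b a ⊕ 1E ⊗ v)) (sym (Z-x-x a)) (sym (Z-x-x b)) ⟩
  (Z a a ⊕ 1E ⊗ Z a b) ⊕ 1E ⊗ (Z b a ⊕ 1E ⊗ Z b b)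
    ≡⟨ cong₂ (λ u v → u ⊕ 1E ⊗ v) (linear₂ a) (linear₂ b) ⟨
  Z a a+b ⊕ 1E ⊗ Z b a+b
    ≡⟨ linear₁ a+b ⟨
  Z a+b a+b
    ≡⟨ Z-x-x a+b ⟩
  0E ∎)
  where
  a b a+b : ℕ → 𝔼
  a = M p
  b = M (suc p)
  a+b j = a j ⊕ 1E ⊗ b j
  p≢p+1 : p ≢ suc p
  p≢p+1 ()
  Z : (ℕ → 𝔼) → (ℕ → 𝔼) → 𝔼
  Z x y = det′ n (setRow p x (setRow (suc p) y M))
  linear₁ : ∀ y → Z a+b y ≡ Z a y ⊕ 1E ⊗ Z b y
  linear₁ y = det′-linear-row n p (<-trans (n<1+n p) p+1<n) (setRow (suc p) y M) a b 1E
  linear₂ : ∀ x → Z x a+b ≡ Z x a ⊕ 1E ⊗ Z x b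
  linear₂ x = begin
    Z x a+b
      ≡⟨ det′-cong n (λ i j _ _ → setRow-comm p≢p+1 x a+b M i j) ⟩
    det′ n (setRow (suc p) a+b (setRow p x M))
      ≡⟨ det′-linear-row n (suc p) p+1<n (setRow p x M) a b 1E ⟩
    det′ n (setRow (suc p) a (setRow p x M)) ⊕ 1E ⊗ det′ n (setRow (suc p) b (setRow p x M))
      ≡⟨ cong₂ (λ u v → u ⊕ 1E ⊗ v) (det′-cong n (λ i j _ _ → sym (setRow-comm p≢p+1 x a M i j)))
                                     (det′-cong n (λ i j _ _ → sym (setRow-comm p≢p+1 x b M i j))) ⟩
    Z x a ⊕ 1E ⊗ Z x b ∎
  Z-x-x : ∀ x → Z x x ≡ 0E
  Z-x-x x = det′-adjacent-equal-rows n p p+1<n (setRow p x (setRow (suc p) x M)) λ j →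
    trans (setRow-hit p x (setRow (suc p) x M) j)
          (sym (trans (setRow-miss x (setRow (suc p) x M) j (p≢p+1 ∘ sym)) (setRow-hit (suc p) x M j)))
  Z-a-b : Z a b ≡ det′ n M
  Z-a-b = det′-cong n λ i j _ _ →
    trans (setRow-id (setRow (suc p) b M) (λ j → sym (setRow-miss b M j p≢p+1)) i j) (setRow-id M (λ _ → refl) i j)
  Z-b-a : Z b a ≡ det′ n (swapRows p M)
  Z-b-a = det′-cong n λ i j _ _ → setRow-swap p M i j
  opaque
    unfolding _⊗_
    simplify : ∀ x y → (0E ⊕ 1E ⊗ x) ⊕ 1E ⊗ (y ⊕ 1E ⊗ 0E) ≡ x ⊕ y
    simplify = solve-∀ 𝔼-ring

det′-equal-rows-< : ∀ n {p} q → p < q → q < n → ∀ M → (∀ j → M p j ≡ M q j) → det′ n M ≡ 0E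
det′-equal-rows-< n {p} (suc q) (s≤s p≤q) q+1<n M Mp≡Mq+1 with m≤n⇒m<n∨m≡n p≤q
... | inj₂ refl = det′-adjacent-equal-rows n p q+1<n M Mp≡Mq+1
... | inj₁ p<q = begin
  det′ n M
    ≡⟨ ⊖-involutive (det′ n M) ⟨
  ⊖ (⊖ det′ n M)
    ≡⟨ cong ⊖_ (det′-swapRows n q q+1<n M) ⟨
  ⊖ det′ n (swapRows q M)
    ≡⟨ cong ⊖_ (det′-equal-rows-< n q p<q (<-trans (n<1+n q) q+1<n) (swapRows q M) rows-equal) ⟩
  ⊖ 0E
    ≡⟨ ⊖-0E ⟩
  0E ∎
  where
  rows-equal : ∀ j → M (swapℕ q p) j ≡ M (swapℕ q q) j
  rows-equal j = trans (cong (λ k → M k j) (swapℕ-miss q (<⇒≢ p<q) (<⇒≢ (<-trans p<q (n<1+n q)))))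
                       (trans (Mp≡Mq+1 j) (cong (λ k → M k j) (sym (swapℕ-hit q))))

det′-equal-rows : ∀ n {p q} → p ≢ q → p < n → q < n → ∀ M → (∀ j → M p j ≡ M q j) → det′ n M ≡ 0E
det′-equal-rows n {p} {q} p≢q p<n q<n M Mp≡Mq with <-cmp p q
... | tri< p<q _ _ = det′-equal-rows-< n q p<q q<n M Mp≡Mq
... | tri≈ _ p≡q _ = contradiction p≡q p≢q
... | tri> _ _ q<p = det′-equal-rows-< n p q<p p<n M (sym ∘ Mp≡Mq)

det′-add-row-multiple : ∀ n {p q} → p ≢ q → p < n → q < n → ∀ M a →
  det′ n (setRow p (λ j → M p j ⊕ a ⊗ M q j) M) ≡ det′ n M
det′-add-row-multiple n {p} {q} p≢q p<n q<n M a = begin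
  det′ n (setRow p (λ j → M p j ⊕ a ⊗ M q j) M)
    ≡⟨ det′-linear-row n p p<n M (M p) (M q) a ⟩
  det′ n (setRow p (M p) M) ⊕ a ⊗ det′ n (setRow p (M q) M)
    ≡⟨ cong₂ (λ u v → u ⊕ a ⊗ v) unchanged duplicated ⟩
  det′ n M ⊕ a ⊗ 0E
    ≡⟨ ⊕-⊗-zeroʳ (det′ n M) a ⟩
  det′ n M ∎
  where
  unchanged : det′ n (setRow p (M p) M) ≡ det′ n M
  unchanged = det′-cong n λ i j _ _ → setRow-id M (λ _ → refl) i j
  duplicated : det′ n (setRow p (M q) M) ≡ 0E
  duplicated = det′-equal-rows n p≢q p<n q<n (setRow p (M q) M) λ j →
    trans (setRow-hit p (M q) M j) (sym (setRow-miss (M q) M j (p≢q ∘ sym)))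

-- Row i receives κ i times row g i; a row that is a source of a nonzero multiple is left unchanged.
Admissible : ℕ → (ℕ → 𝔼) → (ℕ → ℕ) → Set
Admissible n κ g = ∀ i → i < n → κ i ≡ 0E ⊎ (g i < n × g i ≢ i × κ (g i) ≡ 0E)

partialRowOps : Matrix → (ℕ → 𝔼) → (ℕ → ℕ) → ℕ → Matrix
partialRowOps M κ g t i j = if i <ᵇ t then M i j ⊕ κ i ⊗ M (g i) j else M i j

module _ (M : Matrix) (κ : ℕ → 𝔼) (g : ℕ → ℕ) where

  private
    partial = partialRowOps M κ g

  partialRowOps-< : ∀ {t i} j → i < t → partial t i j ≡ M i j ⊕ κ i ⊗ M (g i) j
  partialRowOps-< {t} {i} j i<t with i <ᵇ t | <⇒<ᵇ i<t
  ... | true | _ = refl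

  partialRowOps-≥ : ∀ {t i} j → t ≤ i → partial t i j ≡ M i j
  partialRowOps-≥ {t} {i} j t≤i with i <ᵇ t | <ᵇ⇒< i t
  ... | true  | i<t = contradiction (i<t _) (≤⇒≯ t≤i)
  ... | false | _   = refl

  partialRowOps-other : ∀ {t i} j → i ≢ t → partial (suc t) i j ≡ partial t i j
  partialRowOps-other {t} {i} j i≢t with <-cmp i t
  ... | tri< i<t _ _ = trans (partialRowOps-< j (<-trans i<t (n<1+n t))) (sym (partialRowOps-< j i<t))
  ... | tri≈ _ i≡t _ = contradiction i≡t i≢t
  ... | tri> _ _ t<i = trans (partialRowOps-≥ j t<i) (sym (partialRowOps-≥ j (<⇒≤ t<i)))

  det′-partialRowOps-step : ∀ n t → t < n → Admissible n κ g → det′ n (partial (suc t)) ≡ det′ n (partial t)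
  det′-partialRowOps-step n t t<n admissible with admissible t t<n
  ... | inj₁ κt≡0 = det′-cong n λ i j _ _ → row-t-unchanged i j
    where
    row-t-unchanged : ∀ i j → partial (suc t) i j ≡ partial t i j
    row-t-unchanged i j with i ≟ t
    ... | yes refl = trans (partialRowOps-< j (n<1+n i))
                           (trans (trans (cong (λ a → M i j ⊕ a ⊗ M (g i) j) κt≡0) (⊕-⊗-zeroˡ (M i j) (M (g i) j)))
                                  (sym (partialRowOps-≥ j ≤-refl)))
    ... | no i≢t   = partialRowOps-other j i≢t
  ... | inj₂ (gt<n , gt≢t , κgt≡0) =
    trans (det′-cong n λ i j _ _ → as-row-operation i j)
          (det′-add-row-multiple n (gt≢t ∘ sym) t<n gt<n (partial t) (κ t))
    where
    source-unchanged : ∀ j → partial t (g t) j ≡ M (g t) j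
    source-unchanged j with <-cmp (g t) t
    ... | tri< gt<t _ _ = trans (partialRowOps-< j gt<t)
                                (trans (cong (λ a → M (g t) j ⊕ a ⊗ M (g (g t)) j) κgt≡0) (⊕-⊗-zeroˡ _ _))
    ... | tri≈ _ gt≡t _ = contradiction gt≡t gt≢t
    ... | tri> _ _ t<gt = partialRowOps-≥ j (<⇒≤ t<gt)
    row-t : ℕ → 𝔼
    row-t j = partial t t j ⊕ κ t ⊗ partial t (g t) j
    as-row-operation : ∀ i j → partial (suc t) i j ≡ setRow t row-t (partial t) i j
    as-row-operation i j with i ≟ t
    ... | yes refl = trans (partialRowOps-< j (n<1+n i))
                           (sym (trans (setRow-hit i row-t (partial i) j)
                                       (cong₂ (λ u v → u ⊕ κ i ⊗ v) (partialRowOps-≥ j ≤-refl) (source-unchanged j))))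
    ... | no i≢t   = trans (partialRowOps-other j i≢t) (sym (setRow-miss row-t (partial t) j i≢t))

det′-add-row-multiples : ∀ n M κ g → Admissible n κ g → det′ n (λ i j → M i j ⊕ κ i ⊗ M (g i) j) ≡ det′ n M
det′-add-row-multiples n M κ g admissible =
  trans (det′-cong n λ i j i<n _ → sym (partialRowOps-< M κ g j i<n)) (all-rows n ≤-refl)
  where
  all-rows : ∀ t → t ≤ n → det′ n (partialRowOps M κ g t) ≡ det′ n M
  all-rows zero    _   = det′-cong n λ i j _ _ → partialRowOps-≥ M κ g j z≤n
  all-rows (suc t) t<n = trans (det′-partialRowOps-step M κ g n t t<n admissible) (all-rows t (<⇒≤ t<n))

det′-add-col-multiples : ∀ n M κ g → Admissible n κ g → det′ n (λ i j → M i j ⊕ κ j ⊗ M i (g j)) ≡ det′ n M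
det′-add-col-multiples n M κ g admissible = begin
  det′ n (λ i j → M i j ⊕ κ j ⊗ M i (g j))
    ≡⟨ det′-transpose n _ ⟨
  det′ n (λ i j → M j i ⊕ κ i ⊗ M j (g i))
    ≡⟨ det′-add-row-multiples n (λ i j → M j i) κ g admissible ⟩
  det′ n (λ i j → M j i)
    ≡⟨ det′-transpose n M ⟩
  det′ n M ∎

det′-conj-swap : ∀ n p → suc p < n → ∀ M → det′ n (λ i j → M (swapℕ p i) (swapℕ p j)) ≡ det′ n M
det′-conj-swap n p p+1<n M = begin
  det′ n (swapRows p (λ i j → M i (swapℕ p j)))     ≡⟨ det′-swapRows n p p+1<n _ ⟩
  ⊖ det′ n (λ i j → M i (swapℕ p j))                ≡⟨ cong ⊖_ (det′-transpose n _) ⟨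
  ⊖ det′ n (swapRows p (λ i j → M j i))             ≡⟨ cong ⊖_ (det′-swapRows n p p+1<n _) ⟩
  ⊖ (⊖ det′ n (λ i j → M j i))                      ≡⟨ ⊖-involutive _ ⟩
  det′ n (λ i j → M j i)                            ≡⟨ det′-transpose n M ⟩
  det′ n M                                          ∎

-- Simultaneous permutations of rows and columns

pull : ℕ → ℕ → ℕ → ℕ
pull b zero    = id
pull b (suc d) = swapℕ (b + d) ∘ pull b d

swapℕ-below : ∀ p {i} → i < p → swapℕ p i ≡ i
swapℕ-below p i<p = swapℕ-miss p (<⇒≢ i<p) (<⇒≢ (<-trans i<p (n<1+n p)))

swapℕ-above : ∀ p {i} → suc p < i → swapℕ p i ≡ i
swapℕ-above p p+1<i = swapℕ-miss p (>⇒≢ (<-trans (n<1+n p) p+1<i)) (>⇒≢ p+1<i)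

pull-below : ∀ b d {i} → i < b → pull b d i ≡ i
pull-below b zero    i<b = refl
pull-below b (suc d) i<b = trans (cong (swapℕ (b + d)) (pull-below b d i<b)) (swapℕ-below (b + d) (≤-trans i<b (m≤m+n b d)))

pull-target : ∀ b d → pull b d b ≡ b + d
pull-target b zero    = sym (+-identityʳ b)
pull-target b (suc d) = trans (cong (swapℕ (b + d)) (pull-target b d)) (trans (swapℕ-hit (b + d)) (sym (+-suc b d)))

pull-above : ∀ b d {i} → b + d < i → pull b d i ≡ i
pull-above b zero    _       = refl
pull-above b (suc d) {i} b+d+1<i = trans (cong (swapℕ (b + d)) (pull-above b d (<-trans b+d<b+d+1 b+d+1<i)))
                                         (swapℕ-above (b + d) (subst (_< i) (+-suc b d) b+d+1<i))
  where
  b+d<b+d+1 : b + d < b + suc d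
  b+d<b+d+1 = +-monoʳ-< b (n<1+n d)

pull-between : ∀ b d {x} → b ≤ x → x < b + d → pull b d (suc x) ≡ x
pull-between b zero    {x} b≤x x<b = contradiction (subst (x <_) (+-identityʳ b) x<b) (≤⇒≯ b≤x)
pull-between b (suc d) {x} b≤x x<b+d+1 with m≤n⇒m<n∨m≡n (s≤s⁻¹ (subst (x <_) (+-suc b d) x<b+d+1))
... | inj₁ x<b+d  = trans (cong (swapℕ (b + d)) (pull-between b d b≤x x<b+d)) (swapℕ-below (b + d) x<b+d)
... | inj₂ refl   = trans (cong (swapℕ (b + d)) (pull-above b d (n<1+n (b + d)))) (swapℕ-hit′ (b + d))

det′-conj-pull : ∀ n b d → b + d < n → ∀ M → det′ n (λ i j → M (pull b d i) (pull b d j)) ≡ det′ n M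
det′-conj-pull n b zero    _     M = refl
det′-conj-pull n b (suc d) b+d<n M =
  trans (det′-conj-pull n b d (<-trans (+-monoʳ-< b (n<1+n d)) b+d<n) (λ x y → M (swapℕ (b + d) x) (swapℕ (b + d) y)))
        (det′-conj-swap n (b + d) (subst (_< n) (+-suc b d) b+d<n) M)

-- residueSort n enumerates 0, 3, …, 3n - 3, then 1, 4, …, 3n - 2, then 2, 5, …, 3n - 1, then 3n, 3n + 1, …
residueSort : ℕ → ℕ → ℕ
residueSort zero    = id
residueSort (suc n) = residueSort n ∘ pull n (n + n) ∘ pull (suc (n + n)) n

residueSort-beyond : ∀ n a → residueSort n (3 * n + a) ≡ 3 * n + a
residueSort-beyond zero    a = refl
residueSort-beyond (suc n) a = begin
  residueSort n (pull n (n + n) (pull (suc (n + n)) n (3 * suc n + a)))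
    ≡⟨ cong (residueSort n ∘ pull n (n + n)) (pull-above (suc (n + n)) n above₁) ⟩
  residueSort n (pull n (n + n) (3 * suc n + a))
    ≡⟨ cong (residueSort n) (pull-above n (n + n) above₂) ⟩
  residueSort n (3 * suc n + a)   ≡⟨ cong (residueSort n) shift ⟩
  residueSort n (3 * n + (3 + a)) ≡⟨ residueSort-beyond n (3 + a) ⟩
  3 * n + (3 + a)                 ≡⟨ shift ⟨
  3 * suc n + a                   ∎
  where
  shift : 3 * suc n + a ≡ 3 * n + (3 + a)
  shift = ℕ-solve (n ∷ a ∷ [])
  above₁ : suc (n + n) + n < 3 * suc n + a
  above₁ = ≤.begin-strict
    suc (n + n) + n               ≤.<⟨ m<m+n _ z<s ⟩
    suc (n + n) + n + suc (suc a) ≤.≡⟨ ℕ-solve (n ∷ a ∷ []) ⟩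
    3 * suc n + a                 ≤.∎
  above₂ : n + (n + n) < 3 * suc n + a
  above₂ = ≤.begin-strict
    n + (n + n)                   ≤.<⟨ m<m+n _ z<s ⟩
    n + (n + n) + suc (suc (suc a)) ≤.≡⟨ ℕ-solve (n ∷ a ∷ []) ⟩
    3 * suc n + a                 ≤.∎

residueSort-class₀ : ∀ n {a} → a < n → residueSort n a ≡ 3 * a
residueSort-class₀ (suc n) {a} a<n+1 with m≤n⇒m<n∨m≡n (s≤s⁻¹ a<n+1)
... | inj₁ a<n = begin
  residueSort n (pull n (n + n) (pull (suc (n + n)) n a))
    ≡⟨ cong (residueSort n ∘ pull n (n + n)) (pull-below (suc (n + n)) n a<2n+1) ⟩
  residueSort n (pull n (n + n) a)
    ≡⟨ cong (residueSort n) (pull-below n (n + n) a<n) ⟩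
  residueSort n a
    ≡⟨ residueSort-class₀ n a<n ⟩
  3 * a ∎
  where
  a<2n+1 : a < suc (n + n)
  a<2n+1 = ≤-trans a<n+1 (s≤s (m≤m+n n n))
... | inj₂ refl = begin
  residueSort a (pull a (a + a) (pull (suc (a + a)) a a))
    ≡⟨ cong (residueSort a ∘ pull a (a + a)) (pull-below (suc (a + a)) a (s≤s (m≤m+n a a))) ⟩
  residueSort a (pull a (a + a) a)
    ≡⟨ cong (residueSort a) (pull-target a (a + a)) ⟩
  residueSort a (a + (a + a))
    ≡⟨ cong (residueSort a) (ℕ-solve (a ∷ [])) ⟩
  residueSort a (3 * a + 0)
    ≡⟨ residueSort-beyond a 0 ⟩
  3 * a + 0
    ≡⟨ +-identityʳ (3 * a) ⟩
  3 * a ∎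

residueSort-class₁ : ∀ n {a} → a < n → residueSort n (n + a) ≡ 3 * a + 1
residueSort-class₁ (suc n) {a} a<n+1 with m≤n⇒m<n∨m≡n (s≤s⁻¹ a<n+1)
... | inj₁ a<n = begin
  residueSort n (pull n (n + n) (pull (suc (n + n)) n (suc (n + a))))
    ≡⟨ cong (residueSort n ∘ pull n (n + n)) (pull-below (suc (n + n)) n (s≤s (+-monoʳ-< n a<n))) ⟩
  residueSort n (pull n (n + n) (suc (n + a)))
    ≡⟨ cong (residueSort n) (pull-between n (n + n) (m≤m+n n a) (+-monoʳ-< n (<-≤-trans a<n (m≤m+n n n)))) ⟩
  residueSort n (n + a)
    ≡⟨ residueSort-class₁ n a<n ⟩
  3 * a + 1 ∎
... | inj₂ refl = begin
  residueSort a (pull a (a + a) (pull (suc (a + a)) a (suc (a + a))))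
    ≡⟨ cong (residueSort a ∘ pull a (a + a)) (pull-target (suc (a + a)) a) ⟩
  residueSort a (pull a (a + a) (suc (a + a) + a))
    ≡⟨ cong (residueSort a) (pull-above a (a + a) above) ⟩
  residueSort a (suc (a + a) + a)
    ≡⟨ cong (residueSort a) (ℕ-solve (a ∷ [])) ⟩
  residueSort a (3 * a + 1)
    ≡⟨ residueSort-beyond a 1 ⟩
  3 * a + 1 ∎
  where
  above : a + (a + a) < suc (a + a) + a
  above = ≤.begin-strict
    a + (a + a)            ≤.<⟨ n<1+n _ ⟩
    suc (a + (a + a))      ≤.≡⟨ ℕ-solve (a ∷ []) ⟩
    suc (a + a) + a        ≤.∎

residueSort-class₂ : ∀ n {a} → a < n → residueSort n (n + (n + a)) ≡ 3 * a + 2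
residueSort-class₂ (suc n) {a} a<n+1 with m≤n⇒m<n∨m≡n (s≤s⁻¹ a<n+1)
... | inj₁ a<n = begin
  residueSort n (pull n (n + n) (pull (suc (n + n)) n (suc n + (suc n + a))))
    ≡⟨ cong (residueSort n ∘ pull n (n + n) ∘ pull (suc (n + n)) n) (ℕ-solve (n ∷ a ∷ [])) ⟩
  residueSort n (pull n (n + n) (pull (suc (n + n)) n (suc (suc (n + (n + a))))))
    ≡⟨ cong (residueSort n ∘ pull n (n + n)) (pull-between (suc (n + n)) n (s≤s (+-monoʳ-≤ n (m≤m+n n a))) between₁) ⟩
  residueSort n (pull n (n + n) (suc (n + (n + a))))
    ≡⟨ cong (residueSort n) (pull-between n (n + n) (m≤m+n n (n + a)) (+-monoʳ-< n (+-monoʳ-< n a<n))) ⟩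
  residueSort n (n + (n + a))
    ≡⟨ residueSort-class₂ n a<n ⟩
  3 * a + 2 ∎
  where
  between₁ : suc (n + (n + a)) < suc (n + n) + n
  between₁ = ≤.begin-strict
    suc (n + (n + a))  ≤.<⟨ s≤s (+-monoʳ-< n (+-monoʳ-< n a<n)) ⟩
    suc (n + (n + n))  ≤.≡⟨ ℕ-solve (n ∷ []) ⟩
    suc (n + n) + n    ≤.∎
... | inj₂ refl = begin
  residueSort a (pull a (a + a) (pull (suc (a + a)) a (suc a + (suc a + a))))
    ≡⟨ cong (residueSort a ∘ pull a (a + a)) (pull-above (suc (a + a)) a above₁) ⟩
  residueSort a (pull a (a + a) (suc a + (suc a + a)))
    ≡⟨ cong (residueSort a) (pull-above a (a + a) above₂) ⟩
  residueSort a (suc a + (suc a + a))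
    ≡⟨ cong (residueSort a) (ℕ-solve (a ∷ [])) ⟩
  residueSort a (3 * a + 2)
    ≡⟨ residueSort-beyond a 2 ⟩
  3 * a + 2 ∎
  where
  above₁ : suc (a + a) + a < suc a + (suc a + a)
  above₁ = ≤.begin-strict
    suc (a + a) + a              ≤.<⟨ n<1+n _ ⟩
    suc (suc (a + a) + a)        ≤.≡⟨ ℕ-solve (a ∷ []) ⟩
    suc a + (suc a + a)          ≤.∎
  above₂ : a + (a + a) < suc a + (suc a + a)
  above₂ = ≤.begin-strict
    a + (a + a)                  ≤.<⟨ ≤-trans (n<1+n _) (n≤1+n _) ⟩
    suc (suc (a + (a + a)))      ≤.≡⟨ ℕ-solve (a ∷ []) ⟩
    suc a + (suc a + a)          ≤.∎

det′-conj-residueSort : ∀ n N → 3 * n ≤ suc N → ∀ M → det′ N (λ i j → M (residueSort n i) (residueSort n j)) ≡ det′ N M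
det′-conj-residueSort zero    N _       M = refl
det′-conj-residueSort (suc n) N 3n+3≤N+1 M =
  trans (det′-conj-pull N (suc (n + n)) n bound₁ (λ x y → M (residueSort n (pull n (n + n) x)) (residueSort n (pull n (n + n) y))))
  (trans (det′-conj-pull N n (n + n) bound₂ (λ x y → M (residueSort n x) (residueSort n y)))
         (det′-conj-residueSort n N bound₃ M))
  where
  bound₁ : suc (n + n) + n < N
  bound₁ = s≤s⁻¹ (≤.begin
    suc (suc (suc (n + n) + n))  ≤.≡⟨ ℕ-solve (n ∷ []) ⟩
    3 * suc n                    ≤.≤⟨ 3n+3≤N+1 ⟩
    suc N                        ≤.∎)
  bound₂ : n + (n + n) < N
  bound₂ = ≤.begin-strict
    n + (n + n)      ≤.≡⟨ ℕ-solve (n ∷ []) ⟩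
    n + n + n        ≤.<⟨ n<1+n _ ⟩
    suc (n + n) + n  ≤.<⟨ bound₁ ⟩
    N                ≤.∎
  bound₃ : 3 * n ≤ suc N
  bound₃ = ≤.begin
    3 * n        ≤.≤⟨ m≤m+n (3 * n) 3 ⟩
    3 * n + 3    ≤.≡⟨ ℕ-solve (n ∷ []) ⟩
    3 * suc n    ≤.≤⟨ 3n+3≤N+1 ⟩
    suc N        ≤.∎

-- Block triangular matrices

punchInℕ-≥ : ∀ j l → j ≤ l → punchInℕ j l ≡ suc l
punchInℕ-≥ zero    l       _         = refl
punchInℕ-≥ (suc j) (suc l) (s≤s j≤l) = cong suc (punchInℕ-≥ j l j≤l)

det′-block-triangular : ∀ k m M → (∀ i j → i < k → k ≤ j → j < k + m → M i j ≡ 0E) →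
  det′ (k + m) M ≡ det′ k M ⊗ det′ m (λ i j → M (k + i) (k + j))
det′-block-triangular zero    m M _          = sym (⊗-identityˡ (det′ m M))
det′-block-triangular (suc k) m M upper-zero = begin
  ∑ (suc k + m) term
    ≡⟨ ∑-split (suc k) m term ⟩
  ∑ (suc k) term ⊕ ∑ m (λ j → term (suc k + j))
    ≡⟨ cong₂ _⊕_ left-columns right-columns ⟩
  ∑ (suc k) (λ j → B ⊗ (sgn j ⊗ M 0 j ⊗ det′ k (minor 0 j M))) ⊕ 0E
                                                               ≡⟨ ⊕-identityʳ _ ⟩
  ∑ (suc k) (λ j → B ⊗ (sgn j ⊗ M 0 j ⊗ det′ k (minor 0 j M)))
    ≡⟨ ∑-factorˡ (suc k) B _ ⟩
  B ⊗ det′ (suc k) M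
    ≡⟨ ⊗-comm B (det′ (suc k) M) ⟩
  det′ (suc k) M ⊗ B ∎
  where
  term : ℕ → 𝔼
  term j = sgn j ⊗ M 0 j ⊗ det′ (k + m) (minor 0 j M)
  B : 𝔼
  B = det′ m (λ i j → M (suc k + i) (suc k + j))
  minor-triangular : ∀ j → j < suc k → det′ (k + m) (minor 0 j M) ≡ det′ k (minor 0 j M) ⊗ B
  minor-triangular j j≤k = trans
    (det′-block-triangular k m (minor 0 j M) λ i l i<k k≤l l<k+m →
      trans (cong (M (suc i)) (punchInℕ-≥ j l (≤-trans (s≤s⁻¹ j≤k) k≤l)))
            (upper-zero (suc i) (suc l) (s<s i<k) (s≤s k≤l) (s<s l<k+m)))
    (cong (det′ k (minor 0 j M) ⊗_) (det′-cong m λ a b _ _ →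
      cong (M (suc (k + a))) (punchInℕ-≥ j (k + b) (≤-trans (s≤s⁻¹ j≤k) (m≤m+n k b)))))
  left-columns : ∑ (suc k) term ≡ ∑ (suc k) (λ j → B ⊗ (sgn j ⊗ M 0 j ⊗ det′ k (minor 0 j M)))
  left-columns = ∑-cong (suc k) λ j j≤k →
    trans (cong (sgn j ⊗ M 0 j ⊗_) (minor-triangular j j≤k)) (move-right (sgn j ⊗ M 0 j) (det′ k (minor 0 j M)) B)
    where
    opaque
      unfolding _⊗_
      move-right : ∀ a d b → a ⊗ (d ⊗ b) ≡ b ⊗ (a ⊗ d)
      move-right = solve-∀ 𝔼-ring
  right-columns : ∑ m (λ j → term (suc k + j)) ≡ 0E
  right-columns = ∑-0E m λ j j<m →
    trans (cong (λ x → sgn (suc k + j) ⊗ x ⊗ det′ (k + m) (minor 0 (suc k + j) M))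
                (upper-zero 0 (suc k + j) z<s (m≤m+n (suc k) j) (+-monoʳ-< (suc k) j<m)))
          (trans (cong (_⊗ det′ (k + m) (minor 0 (suc k + j) M)) (⊗-zeroʳ (sgn (suc k + j))))
                 (⊗-zeroˡ _))

block-offset : ∀ k {m j} → k ≤ j → j < k + m → ∃[ a ] a < m × k + a ≡ j
block-offset k {m} k≤j j<k+m with m≤n⇒∃[o]m+o≡n k≤j
... | a , refl = a , +-cancelˡ-< k a m j<k+m , refl

residueMinor : ℕ → Matrix → Matrix
residueMinor r M a b = M (3 * a + r) (3 * b + r)

-- In residue order the matrix is block lower triangular.
ResidueTriangular : ℕ → ℕ → ℕ → Matrix → Set
ResidueTriangular k₀ k₁ k₂ M =
    (∀ a b → a < k₀ → b < k₁ → M (3 * a + 0) (3 * b + 1) ≡ 0E)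
  × (∀ a b → a < k₀ → b < k₂ → M (3 * a + 0) (3 * b + 2) ≡ 0E)
  × (∀ a b → a < k₁ → b < k₂ → M (3 * a + 1) (3 * b + 2) ≡ 0E)

record ResidueOrder (k₀ k₁ k₂ : ℕ) (σ : ℕ → ℕ) : Set where
  field
    det′-invariant : ∀ M → det′ (k₀ + (k₁ + k₂)) (λ i j → M (σ i) (σ j)) ≡ det′ (k₀ + (k₁ + k₂)) M
    class₀ : ∀ a → a < k₀ → σ a ≡ 3 * a + 0
    class₁ : ∀ a → a < k₁ → σ (k₀ + a) ≡ 3 * a + 1
    class₂ : ∀ a → a < k₂ → σ (k₀ + (k₁ + a)) ≡ 3 * a + 2

det′-residue-triangular : ∀ {k₀ k₁ k₂ σ} → ResidueOrder k₀ k₁ k₂ σ → ∀ M → ResidueTriangular k₀ k₁ k₂ M →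
  det′ (k₀ + (k₁ + k₂)) M ≡ det′ k₀ (residueMinor 0 M) ⊗ (det′ k₁ (residueMinor 1 M) ⊗ det′ k₂ (residueMinor 2 M))
det′-residue-triangular {k₀} {k₁} {k₂} {σ} order M (zero₀₁ , zero₀₂ , zero₁₂) = begin
  det′ (k₀ + (k₁ + k₂)) M
    ≡⟨ det′-invariant M ⟨
  det′ (k₀ + (k₁ + k₂)) S
    ≡⟨ det′-block-triangular k₀ (k₁ + k₂) S upper₀ ⟩
  det′ k₀ S ⊗ det′ (k₁ + k₂) S′
    ≡⟨ cong (det′ k₀ S ⊗_) (det′-block-triangular k₁ k₂ S′ upper₁) ⟩
  det′ k₀ S ⊗ (det′ k₁ S′ ⊗ det′ k₂ (λ a b → S′ (k₁ + a) (k₁ + b)))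
    ≡⟨ cong₂ (λ x y → x ⊗ y)
         (det′-cong k₀ λ a b a<k₀ b<k₀ → cong₂ M (class₀ a a<k₀) (class₀ b b<k₀))
         (cong₂ _⊗_ (det′-cong k₁ λ a b a<k₁ b<k₁ → cong₂ M (class₁ a a<k₁) (class₁ b b<k₁))
                    (det′-cong k₂ λ a b a<k₂ b<k₂ → cong₂ M (class₂ a a<k₂) (class₂ b b<k₂))) ⟩
  det′ k₀ (residueMinor 0 M) ⊗ (det′ k₁ (residueMinor 1 M) ⊗ det′ k₂ (residueMinor 2 M)) ∎
  where
  open ResidueOrder order
  S S′ : Matrix
  S i j = M (σ i) (σ j)
  S′ i j = S (k₀ + i) (k₀ + j)
  upper₁ : ∀ i j → i < k₁ → k₁ ≤ j → j < k₁ + k₂ → S′ i j ≡ 0E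
  upper₁ i j i<k₁ k₁≤j j<k₁+k₂ with block-offset k₁ k₁≤j j<k₁+k₂
  ... | a , a<k₂ , refl = trans (cong₂ M (class₁ i i<k₁) (class₂ a a<k₂)) (zero₁₂ i a i<k₁ a<k₂)
  upper₀ : ∀ i j → i < k₀ → k₀ ≤ j → j < k₀ + (k₁ + k₂) → S i j ≡ 0E
  upper₀ i j i<k₀ k₀≤j j<K with block-offset k₀ k₀≤j j<K
  ... | j′ , j′<k₁+k₂ , refl with j′ <? k₁
  ...   | yes j′<k₁ = trans (cong₂ M (class₀ i i<k₀) (class₁ j′ j′<k₁)) (zero₀₁ i j′ i<k₀ j′<k₁)
  ...   | no  j′≮k₁ with block-offset k₁ (≮⇒≥ j′≮k₁) j′<k₁+k₂
  ...     | a , a<k₂ , refl = trans (cong₂ M (class₀ i i<k₀) (class₂ a a<k₂)) (zero₀₂ i a i<k₀ a<k₂)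

residueOrder₀ : ∀ n → ResidueOrder n n n (residueSort n)
residueOrder₀ n = record
  { det′-invariant = det′-conj-residueSort n (n + (n + n)) (≤.begin
      3 * n                ≤.≡⟨ ℕ-solve (n ∷ []) ⟩
      n + (n + n)          ≤.≤⟨ n≤1+n _ ⟩
      suc (n + (n + n))    ≤.∎)
  ; class₀ = λ a a<n → trans (residueSort-class₀ n a<n) (sym (+-identityʳ (3 * a)))
  ; class₁ = λ a → residueSort-class₁ n
  ; class₂ = λ a → residueSort-class₂ n
  }

residueOrder₁ : ∀ n → ResidueOrder (suc n) n n (residueSort n ∘ pull n (n + n))
residueOrder₁ n = record
  { det′-invariant = λ M → trans
      (det′-conj-pull N n (n + n) (≤.begin-strict
          n + (n + n)          ≤.<⟨ n<1+n _ ⟩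
          suc n + (n + n)      ≤.∎) (λ x y → M (residueSort n x) (residueSort n y)))
      (det′-conj-residueSort n N (≤.begin
          3 * n                ≤.≡⟨ ℕ-solve (n ∷ []) ⟩
          n + (n + n)          ≤.≤⟨ ≤-trans (n≤1+n _) (n≤1+n _) ⟩
          suc (suc n + (n + n)) ≤.∎) M)
  ; class₀ = class₀
  ; class₁ = λ a a<n → trans (cong (residueSort n) (pull-between n (n + n) (m≤m+n n a) (+-monoʳ-< n (<-≤-trans a<n (m≤m+n n n)))))
                             (residueSort-class₁ n a<n)
  ; class₂ = λ a a<n → trans (cong (residueSort n) (pull-between n (n + n) (m≤m+n n (n + a)) (+-monoʳ-< n (+-monoʳ-< n a<n))))
                             (residueSort-class₂ n a<n)
  }
  where
  N = suc n + (n + n)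
  class₀ : ∀ a → a < suc n → residueSort n (pull n (n + n) a) ≡ 3 * a + 0
  class₀ a a<n+1 with m≤n⇒m<n∨m≡n (s≤s⁻¹ a<n+1)
  ... | inj₁ a<n  = trans (cong (residueSort n) (pull-below n (n + n) a<n))
                          (trans (residueSort-class₀ n a<n) (sym (+-identityʳ (3 * a))))
  ... | inj₂ refl = begin
    residueSort a (pull a (a + a) a)  ≡⟨ cong (residueSort a) (pull-target a (a + a)) ⟩
    residueSort a (a + (a + a))       ≡⟨ cong (residueSort a) (ℕ-solve (a ∷ [])) ⟩
    residueSort a (3 * a + 0)         ≡⟨ residueSort-beyond a 0 ⟩
    3 * a + 0                         ∎

residueOrder₂ : ∀ n → ResidueOrder (suc n) (suc n) n (residueSort (suc n))
residueOrder₂ n = record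
  { det′-invariant = det′-conj-residueSort (suc n) (suc n + (suc n + n)) (≤.begin
      3 * suc n                  ≤.≡⟨ ℕ-solve (n ∷ []) ⟩
      suc (suc n + (suc n + n))  ≤.∎)
  ; class₀ = λ a a<n+1 → trans (residueSort-class₀ (suc n) a<n+1) (sym (+-identityʳ (3 * a)))
  ; class₁ = λ a → residueSort-class₁ (suc n)
  ; class₂ = λ a a<n → residueSort-class₂ (suc n) (<-trans a<n (n<1+n n))
  }

offset : ℕ → ℕ → ℕ
offset t r = if r <ᵇ t then 1 else 0

-- For r, t < 3, the number of indices i < 3n + t with i % 3 ≡ r.
classSize : ℕ → ℕ → ℕ → ℕ
classSize n t r = offset t r + n

det′-residue-factorisation : ∀ n t → t < 3 → ∀ M → let k = classSize n t in
  ResidueTriangular (k 0) (k 1) (k 2) M →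
  det′ (3 * n + t) M ≡ det′ (k 0) (residueMinor 0 M) ⊗ (det′ (k 1) (residueMinor 1 M) ⊗ det′ (k 2) (residueMinor 2 M))
det′-residue-factorisation n 0 _ M triangular = trans (cong (λ N → det′ N M) size)
  (det′-residue-triangular (residueOrder₀ n) M triangular)
  where
  size : 3 * n + 0 ≡ n + (n + n)
  size = ℕ-solve (n ∷ [])
det′-residue-factorisation n 1 _ M triangular = trans (cong (λ N → det′ N M) size)
  (det′-residue-triangular (residueOrder₁ n) M triangular)
  where
  size : 3 * n + 1 ≡ suc n + (n + n)
  size = ℕ-solve (n ∷ [])
det′-residue-factorisation n 2 _ M triangular = trans (cong (λ N → det′ N M) size)
  (det′-residue-triangular (residueOrder₂ n) M triangular)
  where
  size : 3 * n + 2 ≡ suc n + (suc n + n)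
  size = ℕ-solve (n ∷ [])
det′-residue-factorisation n (suc (suc (suc _))) (s≤s (s≤s (s≤s ()))) M triangular

offset-lower : ∀ t r → t < 3 → t ≤ 3 * offset t r + r
offset-lower t r t<3 with r <ᵇ t | <⇒<ᵇ {r} {t}
... | true  | _        = ≤-trans (<⇒≤ t<3) (m≤m+n 3 r)
... | false | r<t⇒⊥    = ≮⇒≥ r<t⇒⊥

offset-upper : ∀ t s → s < 3 → 3 * offset t s + s < 3 + t
offset-upper t s s<3 with s <ᵇ t | <ᵇ⇒< s t
... | true  | s<t = +-monoʳ-< 3 (s<t _)
... | false | _   = <-≤-trans s<3 (m≤m+n 3 t)

index<⇒position< : ∀ n t {q r} → t < 3 → 3 * q + r < 3 * n + t → q < classSize n t r
index<⇒position< n t {q} {r} t<3 3q+r<3n+t with q <? classSize n t r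
... | yes q<k = q<k
... | no  q≮k = contradiction 3q+r<3n+t (≤⇒≯ (≤.begin
  3 * n + t                      ≤.≤⟨ +-monoʳ-≤ (3 * n) (offset-lower t r t<3) ⟩
  3 * n + (3 * offset t r + r)   ≤.≡⟨ regroup n (offset t r) r ⟩
  3 * (offset t r + n) + r       ≤.≤⟨ +-monoˡ-≤ r (*-monoʳ-≤ 3 (≮⇒≥ q≮k)) ⟩
  3 * q + r                      ≤.∎))
  where
  regroup : ∀ n o r → 3 * n + (3 * o + r) ≡ 3 * (o + n) + r
  regroup = ℕ-solve-∀

position<⇒index< : ∀ n t {q s} → s < 3 → q < classSize n t s → 3 * q + s < 3 * n + t
position<⇒index< n t {q} {s} s<3 q<k = +-cancelʳ-< 3 (3 * q + s) (3 * n + t) (≤.begin-strict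
  3 * q + s + 3                  ≤.≡⟨ ℕ-solve (q ∷ s ∷ []) ⟩
  3 * suc q + s                  ≤.≤⟨ +-monoˡ-≤ s (*-monoʳ-≤ 3 q<k) ⟩
  3 * (offset t s + n) + s       ≤.≡⟨ regroup n (offset t s) s ⟨
  3 * n + (3 * offset t s + s)   ≤.<⟨ +-monoʳ-< (3 * n) (offset-upper t s s<3) ⟩
  3 * n + (3 + t)                ≤.≡⟨ ℕ-solve (n ∷ t ∷ []) ⟩
  3 * n + t + 3                  ≤.∎)
  where
  regroup : ∀ n o s → 3 * n + (3 * o + s) ≡ 3 * (o + n) + s
  regroup = ℕ-solve-∀

shifted-index< : ∀ n t {r s δ q} → t < 3 → s < 3 → offset t r + δ ≤ offset t s →
  3 * q + r < 3 * n + t → 3 * (q + δ) + s < 3 * n + t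
shifted-index< n t {r} {s} {δ} {q} t<3 s<3 offsets 3q+r<3n+t = position<⇒index< n t s<3 (≤.begin-strict
  q + δ                  ≤.<⟨ +-monoˡ-< δ (index<⇒position< n t t<3 3q+r<3n+t) ⟩
  offset t r + n + δ     ≤.≡⟨ regroup (offset t r) n δ ⟩
  offset t r + δ + n     ≤.≤⟨ +-monoˡ-≤ n offsets ⟩
  offset t s + n         ≤.∎)
  where
  regroup : ∀ o n δ → o + n + δ ≡ o + δ + n
  regroup = ℕ-solve-∀

-- Linear combinations of shifts of c

-- The list (w₀, w₁, …, wₗ) stands for the sequence m ↦ w₀ c(m) + w₁ c(m+1) + ⋯ + wₗ c(m+l).
LinComb : Set
LinComb = List 𝔼

opaque
  ⟦_⟧ : LinComb → ℕ → 𝔼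
  ⟦ []    ⟧ m = 0E
  ⟦ w ∷ W ⟧ m = w ⊗ c m ⊕ ⟦ W ⟧ (suc m)

  ⟦[]⟧ : ∀ m → ⟦ [] ⟧ m ≡ 0E
  ⟦[]⟧ m = refl

  ⟦∷⟧ : ∀ w W m → ⟦ w ∷ W ⟧ m ≡ w ⊗ c m ⊕ ⟦ W ⟧ (suc m)
  ⟦∷⟧ w W m = refl

infixl 6 _+ᴸ_
infixr 7 _·ᴸ_

_+ᴸ_ : LinComb → LinComb → LinComb
[]      +ᴸ W       = W
(v ∷ V) +ᴸ []      = v ∷ V
(v ∷ V) +ᴸ (w ∷ W) = v +E w ∷ V +ᴸ W

_·ᴸ_ : 𝔼 → LinComb → LinComb
κ ·ᴸ W = map (κ *E_) W

shiftᴸ : ℕ → LinComb → LinComb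
shiftᴸ δ W = replicate δ 0E ++ W

⟦+ᴸ⟧ : ∀ V W m → ⟦ V +ᴸ W ⟧ m ≡ ⟦ V ⟧ m ⊕ ⟦ W ⟧ m
⟦+ᴸ⟧ []      W       m = trans (sym (⊕-identityˡ _)) (cong (_⊕ ⟦ W ⟧ m) (sym (⟦[]⟧ m)))
⟦+ᴸ⟧ (v ∷ V) []      m = trans (sym (⊕-identityʳ _)) (cong (⟦ v ∷ V ⟧ m ⊕_) (sym (⟦[]⟧ m)))
⟦+ᴸ⟧ (v ∷ V) (w ∷ W) m = begin
  ⟦ v +E w ∷ V +ᴸ W ⟧ m
    ≡⟨ ⟦∷⟧ (v +E w) (V +ᴸ W) m ⟩
  (v +E w) ⊗ c m ⊕ ⟦ V +ᴸ W ⟧ (suc m)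
    ≡⟨ cong₂ (λ x y → x ⊗ c m ⊕ y) (sym (⊕≡+E v w)) (⟦+ᴸ⟧ V W (suc m)) ⟩
  (v ⊕ w) ⊗ c m ⊕ (⟦ V ⟧ (suc m) ⊕ ⟦ W ⟧ (suc m))
    ≡⟨ regroup v w (c m) (⟦ V ⟧ (suc m)) (⟦ W ⟧ (suc m)) ⟩
  (v ⊗ c m ⊕ ⟦ V ⟧ (suc m)) ⊕ (w ⊗ c m ⊕ ⟦ W ⟧ (suc m))
    ≡⟨ cong₂ _⊕_ (⟦∷⟧ v V m) (⟦∷⟧ w W m) ⟨
  ⟦ v ∷ V ⟧ m ⊕ ⟦ w ∷ W ⟧ m ∎
  where
  opaque
    unfolding _⊗_
    regroup : ∀ v w x X Y → (v ⊕ w) ⊗ x ⊕ (X ⊕ Y) ≡ (v ⊗ x ⊕ X) ⊕ (w ⊗ x ⊕ Y)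
    regroup = solve-∀ 𝔼-ring

⟦·ᴸ⟧ : ∀ κ W m → ⟦ κ ·ᴸ W ⟧ m ≡ κ ⊗ ⟦ W ⟧ m
⟦·ᴸ⟧ κ []      m = trans (⟦[]⟧ m) (trans (sym (⊗-zeroʳ κ)) (cong (κ ⊗_) (sym (⟦[]⟧ m))))
⟦·ᴸ⟧ κ (w ∷ W) m = begin
  ⟦ κ *E w ∷ κ ·ᴸ W ⟧ m                    ≡⟨ ⟦∷⟧ (κ *E w) (κ ·ᴸ W) m ⟩
  (κ *E w) ⊗ c m ⊕ ⟦ κ ·ᴸ W ⟧ (suc m)
    ≡⟨ cong₂ (λ x y → x ⊗ c m ⊕ y) (sym (⊗≡*E κ w)) (⟦·ᴸ⟧ κ W (suc m)) ⟩
  (κ ⊗ w) ⊗ c m ⊕ κ ⊗ ⟦ W ⟧ (suc m)        ≡⟨ regroup κ w (c m) (⟦ W ⟧ (suc m)) ⟩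
  κ ⊗ (w ⊗ c m ⊕ ⟦ W ⟧ (suc m))            ≡⟨ cong (κ ⊗_) (⟦∷⟧ w W m) ⟨
  κ ⊗ ⟦ w ∷ W ⟧ m                          ∎
  where
  opaque
    unfolding _⊗_
    regroup : ∀ κ w x X → (κ ⊗ w) ⊗ x ⊕ κ ⊗ X ≡ κ ⊗ (w ⊗ x ⊕ X)
    regroup = solve-∀ 𝔼-ring

⟦shiftᴸ⟧ : ∀ δ W m → ⟦ shiftᴸ δ W ⟧ m ≡ ⟦ W ⟧ (δ + m)
⟦shiftᴸ⟧ zero    W m = refl
⟦shiftᴸ⟧ (suc δ) W m = begin
  ⟦ 0E ∷ shiftᴸ δ W ⟧ m                ≡⟨ ⟦∷⟧ 0E (shiftᴸ δ W) m ⟩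
  0E ⊗ c m ⊕ ⟦ shiftᴸ δ W ⟧ (suc m)    ≡⟨ cong (_⊕ ⟦ shiftᴸ δ W ⟧ (suc m)) (⊗-zeroˡ (c m)) ⟩
  0E ⊕ ⟦ shiftᴸ δ W ⟧ (suc m)          ≡⟨ ⊕-identityˡ _ ⟩
  ⟦ shiftᴸ δ W ⟧ (suc m)               ≡⟨ ⟦shiftᴸ⟧ δ W (suc m) ⟩
  ⟦ W ⟧ (δ + suc m)                    ≡⟨ cong ⟦ W ⟧ (+-suc δ m) ⟩
  ⟦ W ⟧ (suc δ + m)                    ∎

isZeroE : 𝔼 → Bool
isZeroE ⟨ +0 , +0 ⟩ = true
isZeroE _           = false

isZeroE-sound : ∀ x → True (isZeroE x) → x ≡ 0E
isZeroE-sound ⟨ +0 , +0 ⟩ _ = refl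

isZero : LinComb → Bool
isZero []      = true
isZero (w ∷ W) = isZeroE w ∧ isZero W

isZero-sound : ∀ W → True (isZero W) → ∀ m → ⟦ W ⟧ m ≡ 0E
isZero-sound []      _ m = ⟦[]⟧ m
isZero-sound (w ∷ W) zero-coefficients m with T-∧ {isZeroE w} .Equivalence.to zero-coefficients
... | w≡0 , W≡0 = begin
  ⟦ w ∷ W ⟧ m
    ≡⟨ ⟦∷⟧ w W m ⟩
  w ⊗ c m ⊕ ⟦ W ⟧ (suc m)
    ≡⟨ cong₂ (λ x y → x ⊗ c m ⊕ y) (isZeroE-sound w w≡0) (isZero-sound W W≡0 (suc m)) ⟩
  0E ⊗ c m ⊕ 0E
    ≡⟨ trans (⊕-identityʳ _) (⊗-zeroˡ (c m)) ⟩
  0E ∎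

⟦0E∷⟧ : ∀ W m → ⟦ 0E ∷ W ⟧ m ≡ ⟦ W ⟧ (suc m)
⟦0E∷⟧ W m = ⟦shiftᴸ⟧ 1 W m

⟦[_]⟧ : ∀ w m → ⟦ w ∷ [] ⟧ m ≡ w ⊗ c m
⟦[ w ]⟧ m = trans (⟦∷⟧ w [] m) (trans (cong (w ⊗ c m ⊕_) (⟦[]⟧ (suc m))) (⊕-identityʳ (w ⊗ c m)))

cTable : ℕ → LinComb
cTable 0                   = 1E ∷ []
cTable 1                   = J ∷ []
cTable 2                   = []
cTable (suc (suc (suc q))) = 0E ∷ cTable q

c-table : ∀ q m → c (3 * m + q) ≡ ⟦ cTable q ⟧ m
c-table 0 m = trans (c-digit m 0 z<s) (sym (⟦[ 1E ]⟧ m))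
c-table 1 m = trans (c-digit m 1 (s<s z<s)) (sym (⟦[ J ]⟧ m))
c-table 2 m = trans (c-digit m 2 (s<s (s<s z<s))) (trans (⊗-zeroˡ (c m)) (sym (⟦[]⟧ m)))
c-table (suc (suc (suc q))) m = begin
  c (3 * m + suc (suc (suc q)))  ≡⟨ cong c shift ⟩
  c (3 * suc m + q)              ≡⟨ c-table q (suc m) ⟩
  ⟦ cTable q ⟧ (suc m)           ≡⟨ ⟦0E∷⟧ (cTable q) m ⟨
  ⟦ 0E ∷ cTable q ⟧ m            ∎
  where
  shift : 3 * m + suc (suc (suc q)) ≡ 3 * suc m + q
  shift = ℕ-solve (m ∷ q ∷ [])

table : LinComb → ℕ → LinComb
table []      q = []
table (w ∷ W) q = w ·ᴸ cTable q +ᴸ table W (suc q)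

⟦⟧-table : ∀ W q m → ⟦ W ⟧ (3 * m + q) ≡ ⟦ table W q ⟧ m
⟦⟧-table []      q m = trans (⟦[]⟧ (3 * m + q)) (sym (⟦[]⟧ m))
⟦⟧-table (w ∷ W) q m = begin
  ⟦ w ∷ W ⟧ (3 * m + q)
    ≡⟨ ⟦∷⟧ w W (3 * m + q) ⟩
  w ⊗ c (3 * m + q) ⊕ ⟦ W ⟧ (suc (3 * m + q))
    ≡⟨ cong₂ (λ x y → w ⊗ x ⊕ y) (c-table q m) (trans (cong ⟦ W ⟧ (sym (+-suc (3 * m) q))) (⟦⟧-table W (suc q) m)) ⟩
  w ⊗ ⟦ cTable q ⟧ m ⊕ ⟦ table W (suc q) ⟧ m
    ≡⟨ cong (_⊕ ⟦ table W (suc q) ⟧ m) (⟦·ᴸ⟧ w (cTable q) m) ⟨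
  ⟦ w ·ᴸ cTable q ⟧ m ⊕ ⟦ table W (suc q) ⟧ m
    ≡⟨ ⟦+ᴸ⟧ (w ·ᴸ cTable q) (table W (suc q)) m ⟨
  ⟦ table (w ∷ W) q ⟧ m ∎

Blocks : Set
Blocks = ℕ → ℕ → LinComb

blockMatrix : Blocks → Matrix
blockMatrix S i j = ⟦ S (i % 3) (j % 3) ⟧ (i / 3 + j / 3)

blockMatrix-at : ∀ S a b {r s} → r < 3 → s < 3 → blockMatrix S (3 * a + r) (3 * b + s) ≡ ⟦ S r s ⟧ (a + b)
blockMatrix-at S a b r<3 s<3 =
  cong₂ (λ rs q → ⟦ S (proj₁ rs) (proj₂ rs) ⟧ q) (cong₂ _,_ ([3q+r]%3≡r a r<3) ([3q+r]%3≡r b s<3))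
                                                 (cong₂ _+_ ([3q+r]/3≡q a r<3) ([3q+r]/3≡q b s<3))

hankelBlocks : LinComb → Blocks
hankelBlocks W r s = table W (r + s)

hankel≡blockMatrix : ∀ W i j → ⟦ W ⟧ (i + j) ≡ blockMatrix (hankelBlocks W) i j
hankel≡blockMatrix W i j = trans (cong ⟦ W ⟧ split) (⟦⟧-table W (i % 3 + j % 3) (i / 3 + j / 3))
  where
  regroup : ∀ qᵢ rᵢ qⱼ rⱼ → (3 * qᵢ + rᵢ) + (3 * qⱼ + rⱼ) ≡ 3 * (qᵢ + qⱼ) + (rᵢ + rⱼ)
  regroup = ℕ-solve-∀
  split : i + j ≡ 3 * (i / 3 + j / 3) + (i % 3 + j % 3)
  split = trans (cong₂ _+_ (m≡3[m/3]+m%3 i) (m≡3[m/3]+m%3 j)) (regroup (i / 3) (i % 3) (j / 3) (j % 3))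

-- addCols r s δ κ adds κ times column 3(b + δ) + s to every column 3b + r; addRows acts on rows.
data BlockOp : Set where
  addCols addRows : (r s δ : ℕ) → 𝔼 → BlockOp

transposeBlocks : Blocks → Blocks
transposeBlocks S u v = S v u

addColumns : ℕ → ℕ → ℕ → 𝔼 → Blocks → Blocks
addColumns r s δ κ S u v = if v ≡ᵇ r then S u v +ᴸ κ ·ᴸ shiftᴸ δ (S u s) else S u v

applyOp : BlockOp → Blocks → Blocks
applyOp (addCols r s δ κ) S = addColumns r s δ κ S
applyOp (addRows r s δ κ) S = transposeBlocks (addColumns r s δ κ (transposeBlocks S))

record ValidShift (t r s δ : ℕ) : Set where
  field
    classes-differ : r ≢ s
    source<3       : s < 3
    in-range       : offset t r + δ ≤ offset t s

validShift? : ℕ → ℕ → ℕ → ℕ → Bool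
validShift? t r s δ = not (r ≡ᵇ s) ∧ (s <ᵇ 3) ∧ (offset t r + δ ≤ᵇ offset t s)

validShift-sound : ∀ t r s δ → True (validShift? t r s δ) → ValidShift t r s δ
validShift-sound t r s δ valid with T-∧ .Equivalence.to valid
... | r≢ᵇs , rest with T-∧ .Equivalence.to rest
...   | s<ᵇ3 , offsets = record
  { classes-differ = λ r≡s → subst True (T-not-≡ .Equivalence.to r≢ᵇs) (≡⇒≡ᵇ r s r≡s)
  ; source<3       = <ᵇ⇒< s 3 s<ᵇ3
  ; in-range       = ≤ᵇ⇒≤ _ _ offsets
  }

blockMatrix-transpose : ∀ S i j → blockMatrix (transposeBlocks S) i j ≡ blockMatrix S j i
blockMatrix-transpose S i j = cong ⟦ S (j % 3) (i % 3) ⟧ (+-comm (i / 3) (j / 3))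

colCoeff : ℕ → 𝔼 → ℕ → 𝔼
colCoeff r κ j = if j % 3 ≡ᵇ r then κ else 0E

colSource : ℕ → ℕ → ℕ → ℕ
colSource s δ j = 3 * (j / 3 + δ) + s

blockMatrix-addColumns : ∀ {r s δ} κ S → s < 3 → ∀ i j →
  blockMatrix (addColumns r s δ κ S) i j ≡ blockMatrix S i j ⊕ colCoeff r κ j ⊗ blockMatrix S i (colSource s δ j)
blockMatrix-addColumns {r} {s} {δ} κ S s<3 i j with j % 3 ≡ᵇ r
... | false = sym (⊕-⊗-zeroˡ _ _)
... | true  = begin
  ⟦ S (i % 3) (j % 3) +ᴸ κ ·ᴸ shiftᴸ δ (S (i % 3) s) ⟧ (i / 3 + j / 3)
    ≡⟨ ⟦+ᴸ⟧ (S (i % 3) (j % 3)) _ _ ⟩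
  blockMatrix S i j ⊕ ⟦ κ ·ᴸ shiftᴸ δ (S (i % 3) s) ⟧ (i / 3 + j / 3)
    ≡⟨ cong (blockMatrix S i j ⊕_) (trans (⟦·ᴸ⟧ κ _ _) (cong (κ ⊗_) (⟦shiftᴸ⟧ δ _ _))) ⟩
  blockMatrix S i j ⊕ κ ⊗ ⟦ S (i % 3) s ⟧ (δ + (i / 3 + j / 3))
    ≡⟨ cong (λ x → blockMatrix S i j ⊕ κ ⊗ x) (cong₂ (λ v q → ⟦ S (i % 3) v ⟧ q) (sym source-class) position) ⟩
  blockMatrix S i j ⊕ κ ⊗ blockMatrix S i (colSource s δ j) ∎
  where
  source-class : colSource s δ j % 3 ≡ s
  source-class = [3q+r]%3≡r (j / 3 + δ) s<3
  regroup : ∀ δ a b → δ + (a + b) ≡ a + (b + δ)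
  regroup = ℕ-solve-∀
  position : δ + (i / 3 + j / 3) ≡ i / 3 + colSource s δ j / 3
  position = trans (regroup δ (i / 3) (j / 3)) (cong (i / 3 +_) (sym ([3q+r]/3≡q (j / 3 + δ) s<3)))

addColumns-admissible : ∀ n t {r s δ} κ → t < 3 → ValidShift t r s δ → Admissible (3 * n + t) (colCoeff r κ) (colSource s δ)
addColumns-admissible n t {r} {s} {δ} κ t<3 valid j j<N with j % 3 ≡ᵇ r | ≡ᵇ⇒≡ (j % 3) r
... | false | _   = inj₁ refl
... | true  | j∈r = inj₂ (source<N , source≢j , coeff-source≡0)
  where
  open ValidShift valid
  j%3≡r : j % 3 ≡ r
  j%3≡r = j∈r _
  source-class : colSource s δ j % 3 ≡ s
  source-class = [3q+r]%3≡r (j / 3 + δ) source<3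
  source<N : colSource s δ j < 3 * n + t
  source<N = shifted-index< n t {q = j / 3} t<3 source<3 in-range
               (subst (_< 3 * n + t) (trans (m≡3[m/3]+m%3 j) (cong (3 * (j / 3) +_) j%3≡r)) j<N)
  source≢j : colSource s δ j ≢ j
  source≢j source≡j = classes-differ (trans (sym j%3≡r) (trans (cong (_% 3) (sym source≡j)) source-class))
  coeff-source≡0 : colCoeff r κ (colSource s δ j) ≡ 0E
  coeff-source≡0 rewrite source-class with s ≡ᵇ r | ≡ᵇ⇒≡ s r
  ... | false | _   = refl
  ... | true  | s∈r = contradiction (sym (s∈r _)) classes-differ

det′-addColumns : ∀ n t {r s δ} κ S → t < 3 → ValidShift t r s δ →
  det′ (3 * n + t) (blockMatrix (addColumns r s δ κ S)) ≡ det′ (3 * n + t) (blockMatrix S)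
det′-addColumns n t {r} {s} {δ} κ S t<3 valid = trans
  (det′-cong (3 * n + t) λ i j _ _ → blockMatrix-addColumns κ S (ValidShift.source<3 valid) i j)
  (det′-add-col-multiples (3 * n + t) (blockMatrix S) (colCoeff r κ) (colSource s δ) (addColumns-admissible n t κ t<3 valid))

det′-addRows : ∀ n t {r s δ} κ S → t < 3 → ValidShift t r s δ →
  det′ (3 * n + t) (blockMatrix (applyOp (addRows r s δ κ) S)) ≡ det′ (3 * n + t) (blockMatrix S)
det′-addRows n t {r} {s} {δ} κ S t<3 valid = begin
  det′ N (blockMatrix (transposeBlocks (addColumns r s δ κ (transposeBlocks S))))
    ≡⟨ det′-cong N (λ i j _ _ → blockMatrix-transpose (addColumns r s δ κ (transposeBlocks S)) i j) ⟩
  det′ N (λ i j → blockMatrix (addColumns r s δ κ (transposeBlocks S)) j i)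
    ≡⟨ det′-transpose N _ ⟩
  det′ N (blockMatrix (addColumns r s δ κ (transposeBlocks S)))
    ≡⟨ det′-addColumns n t κ (transposeBlocks S) t<3 valid ⟩
  det′ N (blockMatrix (transposeBlocks S))
    ≡⟨ det′-cong N (λ i j _ _ → blockMatrix-transpose S i j) ⟩
  det′ N (λ i j → blockMatrix S j i)
    ≡⟨ det′-transpose N _ ⟩
  det′ N (blockMatrix S)
    ∎
  where
  N = 3 * n + t

validOp? : ℕ → BlockOp → Bool
validOp? t (addCols r s δ _) = validShift? t r s δ
validOp? t (addRows r s δ _) = validShift? t r s δ

det′-applyOp : ∀ n t op S → t < 3 → True (validOp? t op) →
  det′ (3 * n + t) (blockMatrix (applyOp op S)) ≡ det′ (3 * n + t) (blockMatrix S)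
det′-applyOp n t (addCols r s δ κ) S t<3 valid = det′-addColumns n t κ S t<3 (validShift-sound t r s δ valid)
det′-applyOp n t (addRows r s δ κ) S t<3 valid = det′-addRows n t κ S t<3 (validShift-sound t r s δ valid)

applyOps : List BlockOp → Blocks → Blocks
applyOps []         S = S
applyOps (op ∷ ops) S = applyOps ops (applyOp op S)

validOps? : ℕ → List BlockOp → Bool
validOps? t []         = true
validOps? t (op ∷ ops) = validOp? t op ∧ validOps? t ops

det′-applyOps : ∀ n t ops S → t < 3 → True (validOps? t ops) →
  det′ (3 * n + t) (blockMatrix (applyOps ops S)) ≡ det′ (3 * n + t) (blockMatrix S)
det′-applyOps n t []         S t<3 _     = refl
det′-applyOps n t (op ∷ ops) S t<3 valid with T-∧ .Equivalence.to valid
... | valid-op , valid-ops = trans (det′-applyOps n t ops (applyOp op S) t<3 valid-ops) (det′-applyOp n t op S t<3 valid-op)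

-- Reduction of Hankel determinants

hankelDet : LinComb → ℕ → 𝔼
hankelDet W k = det′ k (λ a b → ⟦ W ⟧ (a + b))

_^_ : 𝔼 → ℕ → 𝔼
κ ^ zero  = 1E
κ ^ suc k = κ ⊗ κ ^ k

det′-scale : ∀ k κ M → det′ k (λ a b → κ ⊗ M a b) ≡ κ ^ k ⊗ det′ k M
det′-scale zero    κ M = sym (⊗-identityʳ 1E)
det′-scale (suc k) κ M = trans
  (∑-cong (suc k) λ j _ → trans (cong (sgn j ⊗ (κ ⊗ M 0 j) ⊗_) (det′-scale k κ (minor 0 j M)))
                                (regroup (sgn j) κ (M 0 j) (κ ^ k) (det′ k (minor 0 j M))))
  (∑-factorˡ (suc k) (κ ⊗ κ ^ k) _)
  where
  opaque
    unfolding _⊗_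
    regroup : ∀ s κ m p d → s ⊗ (κ ⊗ m) ⊗ (p ⊗ d) ≡ (κ ⊗ p) ⊗ (s ⊗ m ⊗ d)
    regroup = solve-∀ 𝔼-ring

scaledBy? : LinComb → 𝔼 → LinComb → Bool
scaledBy? V κ W = isZero (V +ᴸ (-E κ) ·ᴸ W)

scaledBy-sound : ∀ V κ W → True (scaledBy? V κ W) → ∀ m → ⟦ V ⟧ m ≡ κ ⊗ ⟦ W ⟧ m
scaledBy-sound V κ W difference≡0 m = begin
  ⟦ V ⟧ m                                       ≡⟨ regroup (⟦ V ⟧ m) κ (⟦ W ⟧ m) ⟩
  (⟦ V ⟧ m ⊕ ⊖ κ ⊗ ⟦ W ⟧ m) ⊕ κ ⊗ ⟦ W ⟧ m       ≡⟨ cong (_⊕ κ ⊗ ⟦ W ⟧ m) difference ⟩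
  0E ⊕ κ ⊗ ⟦ W ⟧ m                              ≡⟨ ⊕-identityˡ _ ⟩
  κ ⊗ ⟦ W ⟧ m                                   ∎
  where
  difference : ⟦ V ⟧ m ⊕ ⊖ κ ⊗ ⟦ W ⟧ m ≡ 0E
  difference = begin
    ⟦ V ⟧ m ⊕ ⊖ κ ⊗ ⟦ W ⟧ m          ≡⟨ cong (λ x → ⟦ V ⟧ m ⊕ x ⊗ ⟦ W ⟧ m) (⊖≡-E κ) ⟩
    ⟦ V ⟧ m ⊕ (-E κ) ⊗ ⟦ W ⟧ m       ≡⟨ cong (⟦ V ⟧ m ⊕_) (⟦·ᴸ⟧ (-E κ) W m) ⟨
    ⟦ V ⟧ m ⊕ ⟦ (-E κ) ·ᴸ W ⟧ m      ≡⟨ ⟦+ᴸ⟧ V _ m ⟨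
    ⟦ V +ᴸ (-E κ) ·ᴸ W ⟧ m           ≡⟨ isZero-sound _ difference≡0 m ⟩
    0E                               ∎
  opaque
    unfolding _⊗_
    regroup : ∀ v κ w → v ≡ (v ⊕ ⊖ κ ⊗ w) ⊕ κ ⊗ w
    regroup = solve-∀ 𝔼-ring

-- Admissible block operations taking the block Hankel matrices of W of the orders 3n + t to block
-- triangular form with diagonal blocks κᵣ times Hankel matrices of Wᵣ; all fields after W₂ are
-- checked by evaluation.
record Reduction (t : ℕ) (W : LinComb) : Set where
  field
    ops      : List BlockOp
    κ₀ κ₁ κ₂ : 𝔼
    W₀ W₁ W₂ : LinComb

  reduced : Blocks
  reduced = applyOps ops (hankelBlocks W)

  field
    t<3        : True (t <ᵇ 3)
    admissible : True (validOps? t ops)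
    zero₀₁     : True (isZero (reduced 0 1))
    zero₀₂     : True (isZero (reduced 0 2))
    zero₁₂     : True (isZero (reduced 1 2))
    diagonal₀  : True (scaledBy? (reduced 0 0) κ₀ W₀)
    diagonal₁  : True (scaledBy? (reduced 1 1) κ₁ W₁)
    diagonal₂  : True (scaledBy? (reduced 2 2) κ₂ W₂)

private
  0<3 : 0 < 3
  0<3 = z<s
  1<3 : 1 < 3
  1<3 = s<s z<s
  2<3 : 2 < 3
  2<3 = s<s (s<s z<s)

hankelDet-reduction : ∀ {t W} (red : Reduction t W) n → let open Reduction red; k = classSize n t in
  hankelDet W (3 * n + t)
    ≡ (κ₀ ^ k 0 ⊗ hankelDet W₀ (k 0)) ⊗ ((κ₁ ^ k 1 ⊗ hankelDet W₁ (k 1)) ⊗ (κ₂ ^ k 2 ⊗ hankelDet W₂ (k 2)))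
hankelDet-reduction {t} {W} red n = begin
  hankelDet W N
    ≡⟨ det′-cong N (λ i j _ _ → hankel≡blockMatrix W i j) ⟩
  det′ N (blockMatrix (hankelBlocks W))
    ≡⟨ det′-applyOps n t ops (hankelBlocks W) (<ᵇ⇒< t 3 t<3) admissible ⟨
  det′ N (blockMatrix reduced)
    ≡⟨ det′-residue-factorisation n t (<ᵇ⇒< t 3 t<3) (blockMatrix reduced) triangular ⟩
  det′ (k 0) (block 0) ⊗ (det′ (k 1) (block 1) ⊗ det′ (k 2) (block 2))
    ≡⟨ cong₂ _⊗_ (diagonal-block 0<3 diagonal₀ (k 0))
                 (cong₂ _⊗_ (diagonal-block 1<3 diagonal₁ (k 1)) (diagonal-block 2<3 diagonal₂ (k 2))) ⟩
  (κ₀ ^ k 0 ⊗ hankelDet W₀ (k 0)) ⊗ ((κ₁ ^ k 1 ⊗ hankelDet W₁ (k 1)) ⊗ (κ₂ ^ k 2 ⊗ hankelDet W₂ (k 2))) ∎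
  where
  open Reduction red
  N = 3 * n + t
  k = classSize n t
  block : ℕ → Matrix
  block r = residueMinor r (blockMatrix reduced)
  triangular : ResidueTriangular (k 0) (k 1) (k 2) (blockMatrix reduced)
  triangular =
      (λ a b _ _ → trans (blockMatrix-at reduced a b 0<3 1<3) (isZero-sound _ zero₀₁ (a + b)))
    , (λ a b _ _ → trans (blockMatrix-at reduced a b 0<3 2<3) (isZero-sound _ zero₀₂ (a + b)))
    , (λ a b _ _ → trans (blockMatrix-at reduced a b 1<3 2<3) (isZero-sound _ zero₁₂ (a + b)))
  diagonal-block : ∀ {r κ V} → r < 3 → True (scaledBy? (reduced r r) κ V) → ∀ m →
    det′ m (residueMinor r (blockMatrix reduced)) ≡ κ ^ m ⊗ hankelDet V m
  diagonal-block {r} {κ} {V} r<3 scaled m = trans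
    (det′-cong m λ a b _ _ → trans (blockMatrix-at reduced a b r<3 r<3) (scaledBy-sound (reduced r r) κ V scaled (a + b)))
    (det′-scale m κ (λ a b → ⟦ V ⟧ (a + b)))

Pᴸ Qᴸ Rᴸ Tᴸ : LinComb
Pᴸ = 1E ∷ []
Qᴸ = 0E ∷ 1E ∷ []
Rᴸ = 1E ∷ 1E ∷ []
Tᴸ = 0E ∷ 1E ∷ 1E ∷ []

P Q R T : ℕ → 𝔼
P = hankelDet Pᴸ
Q = hankelDet Qᴸ
R = hankelDet Rᴸ
T = hankelDet Tᴸ

J² negJ negJ² : 𝔼
J²    = J *E J
negJ  = -E J
negJ² = -E J²

P-reduction₀ : Reduction 0 Pᴸ
P-reduction₀ = record { ops = addCols 1 0 0 negJ ∷ addRows 1 2 0 negJ² ∷ []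
                      ; κ₀ = 1E ; κ₁ = negJ² ; κ₂ = J ; W₀ = Pᴸ ; W₁ = Rᴸ ; W₂ = Qᴸ }

P-reduction₁ : Reduction 1 Pᴸ
P-reduction₁ = record { ops = addCols 1 0 0 negJ ∷ addRows 1 2 0 negJ² ∷ []
                      ; κ₀ = 1E ; κ₁ = negJ² ; κ₂ = J ; W₀ = Pᴸ ; W₁ = Rᴸ ; W₂ = Qᴸ }

P-reduction₂ : Reduction 2 Pᴸ
P-reduction₂ = record { ops = addCols 1 0 0 negJ ∷ addCols 2 1 1 J ∷ []
                      ; κ₀ = 1E ; κ₁ = negJ² ; κ₂ = J ; W₀ = Pᴸ ; W₁ = Pᴸ ; W₂ = Tᴸ }

Q-reduction₀ : Reduction 0 Qᴸ
Q-reduction₀ = record { ops = addCols 2 1 0 negJ ∷ addRows 2 1 0 negJ ∷ addRows 0 2 0 J ∷ []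
                      ; κ₀ = J ; κ₁ = 1E ; κ₂ = negJ² ; W₀ = Rᴸ ; W₁ = Qᴸ ; W₂ = Qᴸ }

Q-reduction₁ : Reduction 1 Qᴸ
Q-reduction₁ = record { ops = addCols 2 1 0 negJ ∷ addCols 2 0 1 negJ² ∷ []
                      ; κ₀ = J ; κ₁ = 1E ; κ₂ = negJ² ; W₀ = Pᴸ ; W₁ = Qᴸ ; W₂ = Tᴸ }

Q-reduction₂ : Reduction 2 Qᴸ
Q-reduction₂ = record { ops = addCols 2 1 0 negJ ∷ addCols 2 0 1 negJ² ∷ []
                      ; κ₀ = J ; κ₁ = 1E ; κ₂ = negJ² ; W₀ = Pᴸ ; W₁ = Qᴸ ; W₂ = Tᴸ }

R-reduction₀ : Reduction 0 Rᴸ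
R-reduction₀ = record { ops = addCols 1 0 0 J² ∷ addRows 0 2 0 negJ² ∷ addRows 1 2 0 J ∷ []
                      ; κ₀ = negJ² ; κ₁ = 1E ; κ₂ = J ; W₀ = Rᴸ ; W₁ = Rᴸ ; W₂ = Qᴸ }

R-reduction₁ : Reduction 1 Rᴸ
R-reduction₁ = record { ops = addCols 1 0 0 J² ∷ addCols 2 0 1 J ∷ []
                      ; κ₀ = negJ² ; κ₁ = 1E ; κ₂ = J ; W₀ = Pᴸ ; W₁ = Rᴸ ; W₂ = Tᴸ }

R-reduction₂ : Reduction 2 Rᴸ
R-reduction₂ = record { ops = addCols 1 0 0 J² ∷ addCols 2 0 1 J ∷ []
                      ; κ₀ = negJ² ; κ₁ = 1E ; κ₂ = J ; W₀ = Pᴸ ; W₁ = Rᴸ ; W₂ = Tᴸ }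

T-reduction₀ : Reduction 0 Tᴸ
T-reduction₀ = record { ops = addCols 2 1 0 J² ∷ addRows 0 1 0 J ∷ []
                      ; κ₀ = J ; κ₁ = negJ² ; κ₂ = 1E ; W₀ = Rᴸ ; W₁ = Qᴸ ; W₂ = Tᴸ }

T-reduction₁ : Reduction 1 Tᴸ
T-reduction₁ = record { ops = addCols 2 1 0 J² ∷ addCols 1 0 1 negJ² ∷ []
                      ; κ₀ = J ; κ₁ = negJ² ; κ₂ = 1E ; W₀ = Pᴸ ; W₁ = Tᴸ ; W₂ = Tᴸ }

T-reduction₂ : Reduction 2 Tᴸ
T-reduction₂ = record { ops = addCols 2 1 0 J² ∷ addRows 0 1 0 J ∷ []
                      ; κ₀ = J ; κ₁ = negJ² ; κ₂ = 1E ; W₀ = Rᴸ ; W₁ = Qᴸ ; W₂ = Tᴸ }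

1E^ : ∀ k → 1E ^ k ≡ 1E
1E^ zero    = refl
1E^ (suc k) = trans (⊗-identityˡ (1E ^ k)) (1E^ k)

negJ²^⊗J^ : ∀ k → negJ² ^ k ⊗ J ^ k ≡ sgn k
negJ²^⊗J^ zero    = ⊗-identityˡ 1E
negJ²^⊗J^ (suc k) = trans (regroup (negJ² ^ k) (J ^ k)) (cong ⊖_ (negJ²^⊗J^ k))
  where
  opaque
    unfolding _⊗_
    regroup : ∀ a b → (negJ² ⊗ a) ⊗ (J ⊗ b) ≡ ⊖ (a ⊗ b)
    regroup = solve-∀ 𝔼-ring

regroup-scalars : ∀ {x p q r X Y Z s} →
  x ≡ (p ⊗ X) ⊗ ((q ⊗ Y) ⊗ (r ⊗ Z)) → p ⊗ q ⊗ r ≡ s → x ≡ s ⊗ (X ⊗ (Y ⊗ Z))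
regroup-scalars {x} {p} {q} {r} {X} {Y} {Z} x≡ pqr≡s =
  trans x≡ (trans (regroup p q r X Y Z) (cong (_⊗ (X ⊗ (Y ⊗ Z))) pqr≡s))
  where
  opaque
    unfolding _⊗_
    regroup : ∀ p q r X Y Z → (p ⊗ X) ⊗ ((q ⊗ Y) ⊗ (r ⊗ Z)) ≡ (p ⊗ q ⊗ r) ⊗ (X ⊗ (Y ⊗ Z))
    regroup = solve-∀ 𝔼-ring

-- The scalars of every reduction are 1E, negJ² and J in some order, so their powers multiply to a
-- constant times 1E ^ k ⊗ (negJ² ^ k ⊗ J ^ k) = (-1)^k.
scalar : ∀ k c {x} → x ≡ c ⊗ (1E ^ k ⊗ (negJ² ^ k ⊗ J ^ k)) → x ≡ c ⊗ sgn k
scalar k c x≡ = trans x≡ (cong (c ⊗_) (trans (cong₂ _⊗_ (1E^ k) (negJ²^⊗J^ k)) (⊗-identityˡ (sgn k))))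

unit-scalar : ∀ k {x} → x ≡ 1E ^ k ⊗ (negJ² ^ k ⊗ J ^ k) → x ≡ sgn k
unit-scalar k x≡ = trans (scalar k 1E (trans x≡ (sym (⊗-identityˡ _)))) (⊗-identityˡ (sgn k))

P-3k : ∀ k → P (3 * k + 0) ≡ sgn k ⊗ (P k ⊗ (R k ⊗ Q k))
P-3k k = regroup-scalars (hankelDet-reduction P-reduction₀ k) (unit-scalar k (⊗-assoc (1E ^ k) (negJ² ^ k) (J ^ k)))

P-3k+1 : ∀ k → P (3 * k + 1) ≡ sgn k ⊗ (P (suc k) ⊗ (R k ⊗ Q k))
P-3k+1 k = regroup-scalars (hankelDet-reduction P-reduction₁ k) (unit-scalar k (shuffle (1E ^ k) (negJ² ^ k) (J ^ k)))
  where
  opaque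
    unfolding _⊗_
    shuffle : ∀ o a b → (1E ⊗ o) ⊗ a ⊗ b ≡ o ⊗ (a ⊗ b)
    shuffle = solve-∀ 𝔼-ring

P-3k+2 : ∀ k → P (3 * k + 2) ≡ negJ² ⊗ sgn k ⊗ (P (suc k) ⊗ (P (suc k) ⊗ T k))
P-3k+2 k = regroup-scalars (hankelDet-reduction P-reduction₂ k) (scalar k negJ² (shuffle (1E ^ k) (negJ² ^ k) (J ^ k)))
  where
  opaque
    unfolding _⊗_
    shuffle : ∀ o a b → (1E ⊗ o) ⊗ (negJ² ⊗ a) ⊗ b ≡ negJ² ⊗ (o ⊗ (a ⊗ b))
    shuffle = solve-∀ 𝔼-ring

Q-3k : ∀ k → Q (3 * k + 0) ≡ sgn k ⊗ (R k ⊗ (Q k ⊗ Q k))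
Q-3k k = regroup-scalars (hankelDet-reduction Q-reduction₀ k) (unit-scalar k (shuffle (1E ^ k) (negJ² ^ k) (J ^ k)))
  where
  opaque
    unfolding _⊗_
    shuffle : ∀ o a b → b ⊗ o ⊗ a ≡ o ⊗ (a ⊗ b)
    shuffle = solve-∀ 𝔼-ring

Q-3k+1 : ∀ k → Q (3 * k + 1) ≡ J ⊗ sgn k ⊗ (P (suc k) ⊗ (Q k ⊗ T k))
Q-3k+1 k = regroup-scalars (hankelDet-reduction Q-reduction₁ k) (scalar k J (shuffle (1E ^ k) (negJ² ^ k) (J ^ k)))
  where
  opaque
    unfolding _⊗_
    shuffle : ∀ o a b → (J ⊗ b) ⊗ o ⊗ a ≡ J ⊗ (o ⊗ (a ⊗ b))
    shuffle = solve-∀ 𝔼-ring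

Q-3k+2 : ∀ k → Q (3 * k + 2) ≡ J ⊗ sgn k ⊗ (P (suc k) ⊗ (Q (suc k) ⊗ T k))
Q-3k+2 k = regroup-scalars (hankelDet-reduction Q-reduction₂ k) (scalar k J (shuffle (1E ^ k) (negJ² ^ k) (J ^ k)))
  where
  opaque
    unfolding _⊗_
    shuffle : ∀ o a b → (J ⊗ b) ⊗ (1E ⊗ o) ⊗ a ≡ J ⊗ (o ⊗ (a ⊗ b))
    shuffle = solve-∀ 𝔼-ring

R-3k : ∀ k → R (3 * k + 0) ≡ sgn k ⊗ (R k ⊗ (R k ⊗ Q k))
R-3k k = regroup-scalars (hankelDet-reduction R-reduction₀ k) (unit-scalar k (shuffle (1E ^ k) (negJ² ^ k) (J ^ k)))
  where
  opaque
    unfolding _⊗_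
    shuffle : ∀ o a b → a ⊗ o ⊗ b ≡ o ⊗ (a ⊗ b)
    shuffle = solve-∀ 𝔼-ring

R-3k+1 : ∀ k → R (3 * k + 1) ≡ negJ² ⊗ sgn k ⊗ (P (suc k) ⊗ (R k ⊗ T k))
R-3k+1 k = regroup-scalars (hankelDet-reduction R-reduction₁ k) (scalar k negJ² (shuffle (1E ^ k) (negJ² ^ k) (J ^ k)))
  where
  opaque
    unfolding _⊗_
    shuffle : ∀ o a b → (negJ² ⊗ a) ⊗ o ⊗ b ≡ negJ² ⊗ (o ⊗ (a ⊗ b))
    shuffle = solve-∀ 𝔼-ring

R-3k+2 : ∀ k → R (3 * k + 2) ≡ negJ² ⊗ sgn k ⊗ (P (suc k) ⊗ (R (suc k) ⊗ T k))
R-3k+2 k = regroup-scalars (hankelDet-reduction R-reduction₂ k) (scalar k negJ² (shuffle (1E ^ k) (negJ² ^ k) (J ^ k)))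
  where
  opaque
    unfolding _⊗_
    shuffle : ∀ o a b → (negJ² ⊗ a) ⊗ (1E ⊗ o) ⊗ b ≡ negJ² ⊗ (o ⊗ (a ⊗ b))
    shuffle = solve-∀ 𝔼-ring

T-3k : ∀ k → T (3 * k + 0) ≡ sgn k ⊗ (R k ⊗ (Q k ⊗ T k))
T-3k k = regroup-scalars (hankelDet-reduction T-reduction₀ k) (unit-scalar k (shuffle (1E ^ k) (negJ² ^ k) (J ^ k)))
  where
  opaque
    unfolding _⊗_
    shuffle : ∀ o a b → b ⊗ a ⊗ o ≡ o ⊗ (a ⊗ b)
    shuffle = solve-∀ 𝔼-ring

T-3k+1 : ∀ k → T (3 * k + 1) ≡ J ⊗ sgn k ⊗ (P (suc k) ⊗ (T k ⊗ T k))
T-3k+1 k = regroup-scalars (hankelDet-reduction T-reduction₁ k) (scalar k J (shuffle (1E ^ k) (negJ² ^ k) (J ^ k)))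
  where
  opaque
    unfolding _⊗_
    shuffle : ∀ o a b → (J ⊗ b) ⊗ a ⊗ o ≡ J ⊗ (o ⊗ (a ⊗ b))
    shuffle = solve-∀ 𝔼-ring

T-3k+2 : ∀ k → T (3 * k + 2) ≡ ⊖ 1E ⊗ sgn k ⊗ (R (suc k) ⊗ (Q (suc k) ⊗ T k))
T-3k+2 k = regroup-scalars (hankelDet-reduction T-reduction₂ k) (scalar k (⊖ 1E) (shuffle (1E ^ k) (negJ² ^ k) (J ^ k)))
  where
  opaque
    unfolding _⊗_
    shuffle : ∀ o a b → (J ⊗ b) ⊗ (negJ² ⊗ a) ⊗ o ≡ ⊖ 1E ⊗ (o ⊗ (a ⊗ b))
    shuffle = solve-∀ 𝔼-ring

-- The invariant R m Q m = T m P (m + 1) = (-1)^m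

sgn² : ∀ k → sgn k ⊗ sgn k ≡ 1E
sgn² zero    = ⊗-identityˡ 1E
sgn² (suc k) = trans (neg² (sgn k)) (sgn² k)
  where
  opaque
    unfolding _⊗_
    neg² : ∀ x → ⊖ x ⊗ ⊖ x ≡ x ⊗ x
    neg² = solve-∀ 𝔼-ring

sgn-3k+t : ∀ k t → sgn (3 * k + t) ≡ sgn k ⊗ sgn t
sgn-3k+t zero    t = sym (⊗-identityˡ (sgn t))
sgn-3k+t (suc k) t = begin
  sgn (3 * suc k + t)              ≡⟨ cong sgn three-more ⟩
  ⊖ ⊖ ⊖ sgn (3 * k + t)            ≡⟨ cong (λ x → ⊖ ⊖ ⊖ x) (sgn-3k+t k t) ⟩
  ⊖ ⊖ ⊖ (sgn k ⊗ sgn t)            ≡⟨ signs (sgn k) (sgn t) ⟩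
  ⊖ sgn k ⊗ sgn t                  ∎
  where
  three-more : 3 * suc k + t ≡ suc (suc (suc (3 * k + t)))
  three-more = ℕ-solve (k ∷ t ∷ [])
  opaque
    unfolding _⊗_
    signs : ∀ x y → ⊖ ⊖ ⊖ (x ⊗ y) ≡ ⊖ x ⊗ y
    signs = solve-∀ 𝔼-ring

Invariant : ℕ → Set
Invariant m = (R m ⊗ Q m ≡ sgn m) × (T m ⊗ P (suc m) ≡ sgn m)

drop-squares : ∀ {x c s v y z} →
  x ≡ c ⊗ ((s ⊗ s) ⊗ ((v ⊗ v) ⊗ y)) → s ⊗ s ≡ 1E → v ⊗ v ≡ 1E → c ⊗ y ≡ z → x ≡ z
drop-squares {x} {c} {s} {v} {y} {z} x≡ s²≡1 v²≡1 cy≡z = begin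
  x                                   ≡⟨ x≡ ⟩
  c ⊗ ((s ⊗ s) ⊗ ((v ⊗ v) ⊗ y))       ≡⟨ cong₂ (λ p q → c ⊗ (p ⊗ (q ⊗ y))) s²≡1 v²≡1 ⟩
  c ⊗ (1E ⊗ (1E ⊗ y))                 ≡⟨ cong (c ⊗_) (trans (⊗-identityˡ _) (⊗-identityˡ y)) ⟩
  c ⊗ y                               ≡⟨ cy≡z ⟩
  z                                   ∎

invariant-3k : ∀ k → Invariant k → Invariant (3 * k + 0)
invariant-3k k (RQ≡s , TP≡s) = RQ , TP
  where
  s = sgn k
  RQ² : (R k ⊗ Q k) ⊗ (R k ⊗ Q k) ≡ 1E
  RQ² = trans (cong₂ _⊗_ RQ≡s RQ≡s) (sgn² k)
  finish : ∀ {y} → y ≡ s → 1E ⊗ y ≡ sgn (3 * k + 0)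
  finish y≡s = trans (⊗-identityˡ _) (trans y≡s (sym (trans (sgn-3k+t k 0) (⊗-identityʳ s))))
  opaque
    unfolding _⊗_
    regroup₁ : ∀ s R Q → (s ⊗ (R ⊗ (R ⊗ Q))) ⊗ (s ⊗ (R ⊗ (Q ⊗ Q)))
                       ≡ 1E ⊗ ((s ⊗ s) ⊗ ((R ⊗ Q ⊗ (R ⊗ Q)) ⊗ (R ⊗ Q)))
    regroup₁ = solve-∀ 𝔼-ring
    regroup₂ : ∀ s R Q T P → (s ⊗ (R ⊗ (Q ⊗ T))) ⊗ (s ⊗ (P ⊗ (R ⊗ Q)))
                           ≡ 1E ⊗ ((s ⊗ s) ⊗ ((R ⊗ Q ⊗ (R ⊗ Q)) ⊗ (T ⊗ P)))
    regroup₂ = solve-∀ 𝔼-ring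
  RQ : R (3 * k + 0) ⊗ Q (3 * k + 0) ≡ sgn (3 * k + 0)
  RQ = drop-squares (trans (cong₂ _⊗_ (R-3k k) (Q-3k k)) (regroup₁ s (R k) (Q k))) (sgn² k) RQ² (finish RQ≡s)
  TP : T (3 * k + 0) ⊗ P (suc (3 * k + 0)) ≡ sgn (3 * k + 0)
  TP = drop-squares
    (trans (cong₂ _⊗_ (T-3k k) (trans (cong P (sym (+-suc (3 * k) 0))) (P-3k+1 k))) (regroup₂ s (R k) (Q k) (T k) (P (suc k))))
    (sgn² k) RQ² (finish TP≡s)

invariant-3k+1 : ∀ k → Invariant k → Invariant (3 * k + 1)
invariant-3k+1 k (RQ≡s , TP≡s) = RQ , TP
  where
  s = sgn k
  TP² : (T k ⊗ P (suc k)) ⊗ (T k ⊗ P (suc k)) ≡ 1E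
  TP² = trans (cong₂ _⊗_ TP≡s TP≡s) (sgn² k)
  finish : ∀ {y} → y ≡ s → ⊖ 1E ⊗ y ≡ sgn (3 * k + 1)
  finish y≡s = trans (⊗-comm (⊖ 1E) _) (trans (cong (_⊗ ⊖ 1E) y≡s) (sym (sgn-3k+t k 1)))
  opaque
    unfolding _⊗_
    regroup₁ : ∀ s R Q T P → (negJ² ⊗ s ⊗ (P ⊗ (R ⊗ T))) ⊗ (J ⊗ s ⊗ (P ⊗ (Q ⊗ T)))
                           ≡ ⊖ 1E ⊗ ((s ⊗ s) ⊗ ((T ⊗ P ⊗ (T ⊗ P)) ⊗ (R ⊗ Q)))
    regroup₁ = solve-∀ 𝔼-ring
    regroup₂ : ∀ s T P → (J ⊗ s ⊗ (P ⊗ (T ⊗ T))) ⊗ (negJ² ⊗ s ⊗ (P ⊗ (P ⊗ T)))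
                       ≡ ⊖ 1E ⊗ ((s ⊗ s) ⊗ ((T ⊗ P ⊗ (T ⊗ P)) ⊗ (T ⊗ P)))
    regroup₂ = solve-∀ 𝔼-ring
  RQ : R (3 * k + 1) ⊗ Q (3 * k + 1) ≡ sgn (3 * k + 1)
  RQ = drop-squares (trans (cong₂ _⊗_ (R-3k+1 k) (Q-3k+1 k)) (regroup₁ s (R k) (Q k) (T k) (P (suc k))))
                    (sgn² k) TP² (finish RQ≡s)
  TP : T (3 * k + 1) ⊗ P (suc (3 * k + 1)) ≡ sgn (3 * k + 1)
  TP = drop-squares
    (trans (cong₂ _⊗_ (T-3k+1 k) (trans (cong P (sym (+-suc (3 * k) 1))) (P-3k+2 k))) (regroup₂ s (T k) (P (suc k))))
    (sgn² k) TP² (finish TP≡s)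

invariant-3k+2 : ∀ k → Invariant k → Invariant (suc k) → Invariant (3 * k + 2)
invariant-3k+2 k (_ , TP≡s) (R′Q′≡-s , _) = RQ , TP
  where
  s = sgn k
  TP² : (T k ⊗ P (suc k)) ⊗ (T k ⊗ P (suc k)) ≡ 1E
  TP² = trans (cong₂ _⊗_ TP≡s TP≡s) (sgn² k)
  R′Q′² : (R (suc k) ⊗ Q (suc k)) ⊗ (R (suc k) ⊗ Q (suc k)) ≡ 1E
  R′Q′² = trans (cong₂ _⊗_ R′Q′≡-s R′Q′≡-s) (sgn² (suc k))
  opaque
    unfolding _⊗_
    regroup₁ : ∀ s R Q T P → (negJ² ⊗ s ⊗ (P ⊗ (R ⊗ T))) ⊗ (J ⊗ s ⊗ (P ⊗ (Q ⊗ T)))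
                           ≡ ⊖ 1E ⊗ ((s ⊗ s) ⊗ ((T ⊗ P ⊗ (T ⊗ P)) ⊗ (R ⊗ Q)))
    regroup₁ = solve-∀ 𝔼-ring
    regroup₂ : ∀ s R Q T P → (⊖ 1E ⊗ s ⊗ (R ⊗ (Q ⊗ T))) ⊗ (⊖ s ⊗ (P ⊗ (R ⊗ Q)))
                           ≡ 1E ⊗ ((s ⊗ s) ⊗ ((R ⊗ Q ⊗ (R ⊗ Q)) ⊗ (T ⊗ P)))
    regroup₂ = solve-∀ 𝔼-ring
    signs₁ : ∀ s → ⊖ 1E ⊗ ⊖ s ≡ s ⊗ sgn 2
    signs₁ = solve-∀ 𝔼-ring
    signs₂ : ∀ s → 1E ⊗ s ≡ s ⊗ sgn 2
    signs₂ = solve-∀ 𝔼-ring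
  RQ : R (3 * k + 2) ⊗ Q (3 * k + 2) ≡ sgn (3 * k + 2)
  RQ = drop-squares (trans (cong₂ _⊗_ (R-3k+2 k) (Q-3k+2 k)) (regroup₁ s (R (suc k)) (Q (suc k)) (T k) (P (suc k))))
                    (sgn² k) TP²
                    (trans (cong (⊖ 1E ⊗_) R′Q′≡-s) (trans (signs₁ s) (sym (sgn-3k+t k 2))))
  TP : T (3 * k + 2) ⊗ P (suc (3 * k + 2)) ≡ sgn (3 * k + 2)
  TP = drop-squares
    (trans (cong₂ _⊗_ (T-3k+2 k) (trans (cong P next) (P-3k (suc k)))) (regroup₂ s (R (suc k)) (Q (suc k)) (T k) (P (suc k))))
    (sgn² k) R′Q′²
    (trans (cong (1E ⊗_) TP≡s) (trans (signs₂ s) (sym (sgn-3k+t k 2))))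
    where
    next : suc (3 * k + 2) ≡ 3 * suc k + 0
    next = ℕ-solve (k ∷ [])

hdet≡hankelDet : ∀ p W → (∀ m → c (p + m) ≡ ⟦ W ⟧ m) → ∀ n → hdet p n ≡ hankelDet W n
hdet≡hankelDet p W c≡W n =
  det≡det′ n (Hankel p n) (λ i j → ⟦ W ⟧ (i + j)) λ i j →
    trans (cong c (+-assoc p (toℕ i) (toℕ j))) (c≡W (toℕ i + toℕ j))

hdet≡P : ∀ n → hdet 0 n ≡ P n
hdet≡P = hdet≡hankelDet 0 Pᴸ λ m → sym (trans (⟦[ 1E ]⟧ m) (⊗-identityˡ (c m)))

hdet≡Q : ∀ n → hdet 1 n ≡ Q n
hdet≡Q = hdet≡hankelDet 1 Qᴸ λ m → sym (trans (⟦0E∷⟧ (1E ∷ []) m) (trans (⟦[ 1E ]⟧ (suc m)) (⊗-identityˡ (c (suc m)))))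

invariant-0 : Invariant 0
invariant-0 = ⊗-identityˡ 1E , trans (⊗-identityˡ (P 1)) (sym (hdet≡P 1))

invariant : ∀ m → Invariant m
invariant = <-rec Invariant λ m earlier →
  subst Invariant (sym (m≡3[m/3]+m%3 m)) (by-digit (m / 3) (m % 3) (m%n<n m 3) λ k k< → earlier (subst (k <_) (sym (m≡3[m/3]+m%3 m)) k<))
  where
  by-digit : ∀ q r → r < 3 → (∀ k → k < 3 * q + r → Invariant k) → Invariant (3 * q + r)
  by-digit zero    0 _ _       = invariant-0
  by-digit (suc q) 0 _ earlier = invariant-3k (suc q) (earlier (suc q) (≤.begin-strict
    suc q                     ≤.<⟨ m<m+n (suc q) z<s ⟩
    suc q + suc (suc (q + q)) ≤.≡⟨ ℕ-solve (q ∷ []) ⟩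
    3 * suc q + 0       ≤.∎))
  by-digit q       1 _ earlier = invariant-3k+1 q (earlier q (≤.begin-strict
    q                   ≤.<⟨ m<m+n q z<s ⟩
    q + 1               ≤.≤⟨ +-monoˡ-≤ 1 (m≤m+n q (q + (q + 0))) ⟩
    3 * q + 1           ≤.∎))
  by-digit q       2 _ earlier = invariant-3k+2 q (earlier q (<-trans (n<1+n q) q+1<3q+2)) (earlier (suc q) q+1<3q+2)
    where
    q+1<3q+2 : suc q < 3 * q + 2
    q+1<3q+2 = ≤.begin-strict
      suc q             ≤.<⟨ n<1+n (suc q) ⟩
      2 + q             ≤.≤⟨ +-monoʳ-≤ 2 (m≤m+n q (q + (q + 0))) ⟩
      2 + 3 * q         ≤.≡⟨ +-comm 2 (3 * q) ⟩
      3 * q + 2         ≤.∎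
  by-digit q (suc (suc (suc _))) (s≤s (s≤s (s≤s ()))) _

-- In the recurrences for P and Q the sign sgn n cancels against R n ⊗ Q n or T n ⊗ P (suc n).
cancel-sign : ∀ {s x y} → s ⊗ s ≡ 1E → y ≡ s → s ⊗ (x ⊗ y) ≡ x
cancel-sign {s} {x} {y} s²≡1 y≡s = begin
  s ⊗ (x ⊗ y)   ≡⟨ cong (λ z → s ⊗ (x ⊗ z)) y≡s ⟩
  s ⊗ (x ⊗ s)   ≡⟨ regroup s x ⟩
  x ⊗ (s ⊗ s)   ≡⟨ cong (x ⊗_) s²≡1 ⟩
  x ⊗ 1E        ≡⟨ ⊗-identityʳ x ⟩
  x             ∎
  where
  opaque
    unfolding _⊗_
    regroup : ∀ s x → s ⊗ (x ⊗ s) ≡ x ⊗ (s ⊗ s)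
    regroup = solve-∀ 𝔼-ring

private
  opaque
    unfolding _⊗_
    regroup-T-P : ∀ c s P X T → c ⊗ s ⊗ (P ⊗ (X ⊗ T)) ≡ c ⊗ (s ⊗ (X ⊗ (T ⊗ P)))
    regroup-T-P = solve-∀ 𝔼-ring
    regroup-R-Q : ∀ s R Q → s ⊗ (R ⊗ (Q ⊗ Q)) ≡ s ⊗ (Q ⊗ (R ⊗ Q))
    regroup-R-Q = solve-∀ 𝔼-ring

P-3n : ∀ n → P (3 * n + 0) ≡ P n
P-3n n = trans (P-3k n) (cancel-sign (sgn² n) (proj₁ (invariant n)))

P-3n+1 : ∀ n → P (3 * n + 1) ≡ P (suc n)
P-3n+1 n = trans (P-3k+1 n) (cancel-sign (sgn² n) (proj₁ (invariant n)))

P-3n+2 : ∀ n → P (3 * n + 2) ≡ negJ² ⊗ P (suc n)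
P-3n+2 n = trans (P-3k+2 n) (trans (regroup-T-P negJ² (sgn n) (P (suc n)) (P (suc n)) (T n))
                                   (cong (negJ² ⊗_) (cancel-sign (sgn² n) (proj₂ (invariant n)))))

Q-3n : ∀ n → Q (3 * n + 0) ≡ Q n
Q-3n n = trans (Q-3k n) (trans (regroup-R-Q (sgn n) (R n) (Q n)) (cancel-sign (sgn² n) (proj₁ (invariant n))))

Q-3n+1 : ∀ n → Q (3 * n + 1) ≡ J ⊗ Q n
Q-3n+1 n = trans (Q-3k+1 n) (trans (regroup-T-P J (sgn n) (P (suc n)) (Q n) (T n))
                                   (cong (J ⊗_) (cancel-sign (sgn² n) (proj₂ (invariant n)))))

Q-3n+2 : ∀ n → Q (3 * n + 2) ≡ J ⊗ Q (suc n)
Q-3n+2 n = trans (Q-3k+2 n) (trans (regroup-T-P J (sgn n) (P (suc n)) (Q (suc n)) (T n))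
                                   (cong (J ⊗_) (cancel-sign (sgn² n) (proj₂ (invariant n)))))

hdet₀-3n : ∀ n → hdet 0 (3 * n) ≡ hdet 0 n
hdet₀-3n n = begin
  hdet 0 (3 * n)   ≡⟨ trans (hdet≡P (3 * n)) (cong P (sym (+-identityʳ (3 * n)))) ⟩
  P (3 * n + 0)    ≡⟨ P-3n n ⟩
  P n              ≡⟨ hdet≡P n ⟨
  hdet 0 n         ∎
hdet₀-3n+1 : ∀ n → hdet 0 (3 * n + 1) ≡ hdet 0 (n + 1)
hdet₀-3n+1 n = begin
  hdet 0 (3 * n + 1)   ≡⟨ hdet≡P (3 * n + 1) ⟩
  P (3 * n + 1)        ≡⟨ P-3n+1 n ⟩
  P (suc n)            ≡⟨ trans (hdet≡P (n + 1)) (cong P (+-comm n 1)) ⟨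
  hdet 0 (n + 1)       ∎
hdet₀-3n+2 : ∀ n → hdet 0 (3 * n + 2) ≡ (-E (J *E J)) *E hdet 0 (n + 1)
hdet₀-3n+2 n = begin
  hdet 0 (3 * n + 2)            ≡⟨ hdet≡P (3 * n + 2) ⟩
  P (3 * n + 2)                 ≡⟨ P-3n+2 n ⟩
  negJ² ⊗ P (suc n)             ≡⟨ ⊗≡*E negJ² (P (suc n)) ⟩
  negJ² *E P (suc n)            ≡⟨ cong (negJ² *E_) (trans (hdet≡P (n + 1)) (cong P (+-comm n 1))) ⟨
  negJ² *E hdet 0 (n + 1)       ∎
hdet₁-3n : ∀ n → hdet 1 (3 * n) ≡ hdet 1 n
hdet₁-3n n = begin
  hdet 1 (3 * n)   ≡⟨ trans (hdet≡Q (3 * n)) (cong Q (sym (+-identityʳ (3 * n)))) ⟩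
  Q (3 * n + 0)    ≡⟨ Q-3n n ⟩
  Q n              ≡⟨ hdet≡Q n ⟨
  hdet 1 n         ∎
hdet₁-3n+1 : ∀ n → hdet 1 (3 * n + 1) ≡ J *E hdet 1 n
hdet₁-3n+1 n = begin
  hdet 1 (3 * n + 1)   ≡⟨ hdet≡Q (3 * n + 1) ⟩
  Q (3 * n + 1)        ≡⟨ Q-3n+1 n ⟩
  J ⊗ Q n              ≡⟨ ⊗≡*E J (Q n) ⟩
  J *E Q n             ≡⟨ cong (J *E_) (hdet≡Q n) ⟨
  J *E hdet 1 n        ∎
hdet₁-3n+2 : ∀ n → hdet 1 (3 * n + 2) ≡ J *E hdet 1 (n + 1)
hdet₁-3n+2 n = begin
  hdet 1 (3 * n + 2)   ≡⟨ hdet≡Q (3 * n + 2) ⟩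
  Q (3 * n + 2)        ≡⟨ Q-3n+2 n ⟩
  J ⊗ Q (suc n)        ≡⟨ ⊗≡*E J (Q (suc n)) ⟩
  J *E Q (suc n)       ≡⟨ cong (J *E_) (trans (hdet≡Q (n + 1)) (cong Q (+-comm n 1))) ⟨
  J *E hdet 1 (n + 1)  ∎

theorem1p1 :
    (hdet 0 0 ≡ 1E) × (hdet 0 1 ≡ 1E)
    × (∀ (n : ℕ) → hdet 0 (3 * n) ≡ hdet 0 n)
    × (∀ (n : ℕ) → hdet 0 (3 * n + 1) ≡ hdet 0 (n + 1))
    × (∀ (n : ℕ) → hdet 0 (3 * n + 2) ≡ (-E (J *E J)) *E hdet 0 (n + 1))
    × (hdet 1 0 ≡ 1E)
    × (∀ (n : ℕ) → hdet 1 (3 * n) ≡ hdet 1 n)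
    × (∀ (n : ℕ) → hdet 1 (3 * n + 1) ≡ J *E hdet 1 n)
    × (∀ (n : ℕ) → hdet 1 (3 * n + 2) ≡ J *E hdet 1 (n + 1))
theorem1p1 = refl , refl , hdet₀-3n , hdet₀-3n+1 , hdet₀-3n+2 , refl , hdet₁-3n , hdet₁-3n+1 , hdet₁-3n+2
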